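{- For every calculus $\mathsf{G.WL}$ among the sequent calculi for W-logics, the cut rule — from $\Gamma\Rightarrow A$ and $\Gamma',A\Rightarrow\Delta$ infer $\Gamma,\Gamma'\Rightarrow\Delta$ — is admissible: whenever both premisses are derivable in $\mathsf{G.WL}$, so is the conclusion.
   Context: The language $\mathcal{L}$ consists of the formulas built from a countable set $\mathrm{Atm}$ of propositional variables by $A ::= p \mid \bot \mid A\land A \mid A\lor A \mid A\to A \mid \Box A \mid \Diamond A$. Sequents: $\Gamma\Rightarrow\Delta$, $\Gamma$ a finite multiset of formulas, $\Delta$ a multiset of at most one formula; $\Box\Gamma$ denotes $\{\Box A: A\in\Gamma\}$ as a multiset. In all rules $\Gamma,\Gamma'$ are arbitrary finite multisets and $\Delta$ has at most one formula. Propositional rules: (init) $\Gamma,p\Rightarrow p$ for $p\in\mathrm{Atm}$; (L$\bot$) $\Gamma,\bot\Rightarrow\Delta$; (L$\to$) from $\Gamma,A\to B\Rightarrow A$ and $\Gamma,B\Rightarrow\Delta$ infer $\Gamma,A\to B\Rightarrow\Delta$; (R$\to$) from $\Gamma,A\Rightarrow B$ infer $\Gamma\Rightarrow A\to B$; (R$\land$) from $\Gamma\Rightarrow A$ and $\Gamma\Rightarrow B$ infer $\Gamma\Rightarrow A\land B$; (L$\land$) from $\Gamma,A,B\Rightarrow\Delta$ infer $\Gamma,A\land B\Rightarrow\Delta$; (R$\lor$) from $\Gamma\Rightarrow A_i$ infer $\Gamma\Rightarrow A_1\lor A_2$ ($i=1,2$); (L$\lor$) from $\Gamma,A\Rightarrow\Delta$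 and $\Gamma,B\Rightarrow\Delta$ infer $\Gamma,A\lor B\Rightarrow\Delta$. Modal rules: (M$_\Box$) from $A\Rightarrow B$ infer $\Gamma,\Box A\Rightarrow\Box B$; (M$_\Diamond$) from $A\Rightarrow B$ infer $\Gamma,\Diamond A\Rightarrow\Diamond B$; (Dual$_M$) from $A,B\Rightarrow$ infer $\Gamma,\Box A,\Diamond B\Rightarrow\Delta$; (N$_\Box$) from $\Rightarrow A$ infer $\Gamma\Rightarrow\Box A$; (N$_\Diamond$) from $A\Rightarrow$ infer $\Gamma,\Diamond A\Rightarrow\Delta$; (C$_\Box$) from $\Gamma,A\Rightarrow B$ infer $\Gamma',\Box\Gamma,\Box A\Rightarrow\Box B$; (C$_\Diamond$) from $\Gamma,A\Rightarrow B$ infer $\Gamma',\Box\Gamma,\Diamond A\Rightarrow\Diamond B$; (Dual$_C$) from $\Gamma,A,B\Rightarrow$ infer $\Gamma',\Box\Gamma,\Box A,\Diamond B\Rightarrow\Delta$; (K$_\Box$) from $\Gamma\Rightarrow A$ infer $\Gamma',\Box\Gamma\Rightarrow\Box A$; (K$_\Diamond$) from $\Gamma,A\Rightarrow B$ infer $\Gamma',\Box\Gamma,\Diamond A\Rightarrow\Diamond B$; (Dual$_K$) from $\Gamma,A\Rightarrow$ infer $\Gamma',\Box\Gamma,\Diamond A\Rightarrow\Delta$; (T$_\Box$) from $\Gamma,\Box A,A\Rightarrow\Delta$ infer $\Gamma,\Box A\Rightarrow\Delta$; (T$_\Diamond$) from $\Gamma\Rightarrow A$ infer $\Gamma\Rightarrow\Diamond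 A$; (P$_\Box$) from $A\Rightarrow$ infer $\Gamma,\Box A\Rightarrow\Delta$; (P$_\Diamond$) from $\Rightarrow A$ infer $\Gamma\Rightarrow\Diamond A$; (D) from $A\Rightarrow B$ infer $\Gamma,\Box A\Rightarrow\Diamond B$; (D$_\Box$) from $A,B\Rightarrow$ infer $\Gamma,\Box A,\Box B\Rightarrow\Delta$; (CD) from $\Gamma\Rightarrow A$ infer $\Gamma',\Box\Gamma\Rightarrow\Diamond A$; (CD$_\Box$) from $\Gamma\Rightarrow$ infer $\Gamma',\Box\Gamma\Rightarrow\Delta$. The calculi each contain all propositional rules plus: $\mathsf{G.WM}$: M$_\Box$, M$_\Diamond$, Dual$_M$; $\mathsf{G.WMP}$: $\mathsf{G.WM}$+P$_\Box$+P$_\Diamond$; $\mathsf{G.WMN}$: $\mathsf{G.WM}$+N$_\Box$+N$_\Diamond$; $\mathsf{G.WMNP}$: $\mathsf{G.WMN}$+P$_\Box$+P$_\Diamond$; $\mathsf{G.WMC}$: C$_\Box$, C$_\Diamond$, Dual$_C$; $\mathsf{G.WK}$: K$_\Box$, K$_\Diamond$, Dual$_K$; $\mathsf{G.WMD}$: $\mathsf{G.WM}$+D+D$_\Box$+P$_\Box$+P$_\Diamond$; $\mathsf{G.WMND}$: $\mathsf{G.WMN}$+D+D$_\Box$+P$_\Box$+P$_\Diamond$; $\mathsf{G.WMCD}$: $\mathsf{G.WMC}$+CD+CD$_\Box$; $\mathsf{G.WKD}$: $\mathsf{G.WK}$+CD+CD$_\Box$; $\mathsf{G.WMT}$, $\mathsf{G.WMNT}$,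 $\mathsf{G.WMCT}$, $\mathsf{G.WKT}$: respectively $\mathsf{G.WM}$, $\mathsf{G.WMN}$, $\mathsf{G.WMC}$, $\mathsf{G.WK}$ + T$_\Box$ + T$_\Diamond$. -}

module Defs where

open import Data.Nat using (ℕ)
open import Data.List using (List; []; _∷_; _++_; map; [_])
open import Data.Maybe using (Maybe; just; nothing)
open import Data.List.Membership.Propositional using (_∈_)
open import Data.List.Relation.Binary.Permutation.Propositional using (_↭_)

Atm : Set
Atm = ℕ

infixr 6 _∧'_
infixr 5 _∨'_
infixr 4 _⊃_

data Fm : Set where
  var  : Atm → Fm
  ⊥'   : Fm
  _∧'_ : Fm → Fm → Fm
  _∨'_ : Fm → Fm → Fm
  _⊃_  : Fm → Fm → Fm
  □    : Fm → Fm
  ◇    : Fm → Fm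

-- Antecedents are finite multisets, represented as lists taken modulo
-- permutation (see the `perm` rule below). Succedents have at most one formula.
Ctx : Set
Ctx = List Fm

Succ : Set
Succ = Maybe Fm

□ₗ : Ctx → Ctx
□ₗ = map □

data MRule : Set where
  M□ M◇ DualM N□ N◇ C□ C◇ DualC K□ K◇ DualK T□ T◇ P□ P◇ Dr D□ CD CD□ : MRule

data Calc : Set where
  WM WMP WMN WMNP WMC WK WMD WMND WMCD WKD WMT WMNT WMCT WKT : Calc

rulesOf : Calc → List MRule
rulesOf WM   = M□ ∷ M◇ ∷ DualM ∷ []
rulesOf WMP  = M□ ∷ M◇ ∷ DualM ∷ P□ ∷ P◇ ∷ []
rulesOf WMN  = M□ ∷ M◇ ∷ DualM ∷ N□ ∷ N◇ ∷ []
rulesOf WMNP = M□ ∷ M◇ ∷ DualM ∷ N□ ∷ N◇ ∷ P□ ∷ P◇ ∷ []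
rulesOf WMC  = C□ ∷ C◇ ∷ DualC ∷ []
rulesOf WK   = K□ ∷ K◇ ∷ DualK ∷ []
rulesOf WMD  = M□ ∷ M◇ ∷ DualM ∷ Dr ∷ D□ ∷ P□ ∷ P◇ ∷ []
rulesOf WMND = M□ ∷ M◇ ∷ DualM ∷ N□ ∷ N◇ ∷ Dr ∷ D□ ∷ P□ ∷ P◇ ∷ []
rulesOf WMCD = C□ ∷ C◇ ∷ DualC ∷ CD ∷ CD□ ∷ []
rulesOf WKD  = K□ ∷ K◇ ∷ DualK ∷ CD ∷ CD□ ∷ []
rulesOf WMT  = M□ ∷ M◇ ∷ DualM ∷ T□ ∷ T◇ ∷ []
rulesOf WMNT = M□ ∷ M◇ ∷ DualM ∷ N□ ∷ N◇ ∷ T□ ∷ T◇ ∷ []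
rulesOf WMCT = C□ ∷ C◇ ∷ DualC ∷ T□ ∷ T◇ ∷ []
rulesOf WKT  = K□ ∷ K◇ ∷ DualK ∷ T□ ∷ T◇ ∷ []

Has : Calc → MRule → Set
Has L r = r ∈ rulesOf L

infix 3 _⊢_⇒_

data _⊢_⇒_ (L : Calc) : Ctx → Succ → Set where
  perm  : ∀ {Γ Γ₁ Δ} → Γ ↭ Γ₁ → L ⊢ Γ ⇒ Δ → L ⊢ Γ₁ ⇒ Δ
  init  : ∀ {Γ p} → L ⊢ var p ∷ Γ ⇒ just (var p)
  L⊥    : ∀ {Γ Δ} → L ⊢ ⊥' ∷ Γ ⇒ Δ
  L⊃    : ∀ {Γ A B Δ} → L ⊢ (A ⊃ B) ∷ Γ ⇒ just A → L ⊢ B ∷ Γ ⇒ Δ → L ⊢ (A ⊃ B) ∷ Γ ⇒ Δ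
  R⊃    : ∀ {Γ A B} → L ⊢ A ∷ Γ ⇒ just B → L ⊢ Γ ⇒ just (A ⊃ B)
  R∧    : ∀ {Γ A B} → L ⊢ Γ ⇒ just A → L ⊢ Γ ⇒ just B → L ⊢ Γ ⇒ just (A ∧' B)
  L∧    : ∀ {Γ A B Δ} → L ⊢ A ∷ B ∷ Γ ⇒ Δ → L ⊢ (A ∧' B) ∷ Γ ⇒ Δ
  R∨₁   : ∀ {Γ A B} → L ⊢ Γ ⇒ just A → L ⊢ Γ ⇒ just (A ∨' B)
  R∨₂   : ∀ {Γ A B} → L ⊢ Γ ⇒ just B → L ⊢ Γ ⇒ just (A ∨' B)
  L∨    : ∀ {Γ A B Δ} → L ⊢ A ∷ Γ ⇒ Δ → L ⊢ B ∷ Γ ⇒ Δ → L ⊢ (A ∨' B) ∷ Γ ⇒ Δ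
  rM□    : Has L M□ → ∀ {Γ A B} → L ⊢ [ A ] ⇒ just B → L ⊢ □ A ∷ Γ ⇒ just (□ B)
  rM◇    : Has L M◇ → ∀ {Γ A B} → L ⊢ [ A ] ⇒ just B → L ⊢ ◇ A ∷ Γ ⇒ just (◇ B)
  rDualM : Has L DualM → ∀ {Γ A B Δ} → L ⊢ A ∷ B ∷ [] ⇒ nothing → L ⊢ □ A ∷ ◇ B ∷ Γ ⇒ Δ
  rN□    : Has L N□ → ∀ {Γ A} → L ⊢ [] ⇒ just A → L ⊢ Γ ⇒ just (□ A)
  rN◇    : Has L N◇ → ∀ {Γ A Δ} → L ⊢ [ A ] ⇒ nothing → L ⊢ ◇ A ∷ Γ ⇒ Δ
  rC□    : Has L C□ → ∀ {Γ Γ' A B} → L ⊢ A ∷ Γ ⇒ just B → L ⊢ Γ' ++ □ₗ Γ ++ [ □ A ] ⇒ just (□ B)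
  rC◇    : Has L C◇ → ∀ {Γ Γ' A B} → L ⊢ A ∷ Γ ⇒ just B → L ⊢ Γ' ++ □ₗ Γ ++ [ ◇ A ] ⇒ just (◇ B)
  rDualC : Has L DualC → ∀ {Γ Γ' A B Δ} → L ⊢ A ∷ B ∷ Γ ⇒ nothing → L ⊢ Γ' ++ □ₗ Γ ++ □ A ∷ ◇ B ∷ [] ⇒ Δ
  rK□    : Has L K□ → ∀ {Γ Γ' A} → L ⊢ Γ ⇒ just A → L ⊢ Γ' ++ □ₗ Γ ⇒ just (□ A)
  rK◇    : Has L K◇ → ∀ {Γ Γ' A B} → L ⊢ A ∷ Γ ⇒ just B → L ⊢ Γ' ++ □ₗ Γ ++ [ ◇ A ] ⇒ just (◇ B)
  rDualK : Has L DualK → ∀ {Γ Γ' A Δ} → L ⊢ A ∷ Γ ⇒ nothing → L ⊢ Γ' ++ □ₗ Γ ++ [ ◇ A ] ⇒ Δ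
  rT□    : Has L T□ → ∀ {Γ A Δ} → L ⊢ □ A ∷ A ∷ Γ ⇒ Δ → L ⊢ □ A ∷ Γ ⇒ Δ
  rT◇    : Has L T◇ → ∀ {Γ A} → L ⊢ Γ ⇒ just A → L ⊢ Γ ⇒ just (◇ A)
  rP□    : Has L P□ → ∀ {Γ A Δ} → L ⊢ [ A ] ⇒ nothing → L ⊢ □ A ∷ Γ ⇒ Δ
  rP◇    : Has L P◇ → ∀ {Γ A} → L ⊢ [] ⇒ just A → L ⊢ Γ ⇒ just (◇ A)
  rD     : Has L Dr → ∀ {Γ A B} → L ⊢ [ A ] ⇒ just B → L ⊢ □ A ∷ Γ ⇒ just (◇ B)
  rD□    : Has L D□ → ∀ {Γ A B Δ} → L ⊢ A ∷ B ∷ [] ⇒ nothing → L ⊢ □ A ∷ □ B ∷ Γ ⇒ Δ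
  rCD    : Has L CD → ∀ {Γ Γ' A} → L ⊢ Γ ⇒ just A → L ⊢ Γ' ++ □ₗ Γ ⇒ just (◇ A)
  rCD□   : Has L CD□ → ∀ {Γ Γ' Δ} → L ⊢ Γ ⇒ nothing → L ⊢ Γ' ++ □ₗ Γ ⇒ Δ

module Submission where

-- Gentzen's argument: induction on the cut formula and, inside it, on the two derivations.
-- Weakening, contraction and invertibility of the left rules for ∧, ∨ and (in its second premise)
-- ⊃ hold in every calculus; contraction absorbs the context that the principal ⊃, ∧ and T□
-- reductions duplicate. A cut is pushed up the left derivation until it ends in a right rule,
-- then up the right derivation until the cut formula is principal there as well. Every remaining
-- pair of rules either reduces to cuts on immediate subformulas or never occurs in one calculus,
-- which is checked by evaluation on the fourteen rule sets. In the calculi without M□ a boxed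
-- formula □A is always introduced as □Θ ⇒ □A from Θ ⇒ A (plus weakening), so a single reduction
-- covers a cut into the boxed context of any C- or K-style rule.

open import Defs
open import Data.Nat using (ℕ)
import Data.Nat as ℕ
open import Data.List using (List; []; _∷_; _++_; map; [_])
open import Data.List.Properties using (map-++)
open import Data.Maybe using (just; nothing)
open import Data.Product using (∃; _×_; _,_)
open import Data.Sum using (_⊎_; inj₁; inj₂)
open import Data.Empty using (⊥; ⊥-elim)
open import Induction.WellFounded using (acc; WellFounded; WfRec; module All)
open import Relation.Nullary using (Dec; ¬_; ¬?)
open import Relation.Nullary.Decidable using (True; toWitness; map′; _×-dec_; _→-dec_)
open import Relation.Binary.Definitions using (DecidableEquality)
open import Relation.Binary.PropositionalEquality using (_≡_; refl; cong; trans; sym)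
open import Data.List.Relation.Unary.All using (All; []; _∷_; all?; lookup)
open import Data.List.Relation.Unary.All.Properties using () renaming (++⁺ to All-++⁺)
open import Data.List.Relation.Unary.Any using (here; there)
open import Data.List.Membership.Propositional using (_∈_)
open import Data.List.Membership.Propositional.Properties using (∈-++⁻; ∈-∃++)
open import Data.List.Relation.Binary.Permutation.Propositional
  using (_↭_; prep; swap; ↭-refl; ↭-sym; ↭-trans; ↭-reflexive)
open import Data.List.Relation.Binary.Permutation.Propositional.Properties
import Algebra.Solver.CommutativeMonoid as CommutativeMonoidSolver

module ++-Solver = CommutativeMonoidSolver (++-commutativeMonoid {A = Fm})
open ++-Solver using (solve; _⊜_; _⊕_)

code : MRule → ℕ
code M□ = 0
code M◇ = 1
code DualM = 2
code N□ = 3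
code N◇ = 4
code C□ = 5
code C◇ = 6
code DualC = 7
code K□ = 8
code K◇ = 9
code DualK = 10
code T□ = 11
code T◇ = 12
code P□ = 13
code P◇ = 14
code Dr = 15
code D□ = 16
code CD = 17
code CD□ = 18

decode : ℕ → MRule
decode 0 = M□
decode 1 = M◇
decode 2 = DualM
decode 3 = N□
decode 4 = N◇
decode 5 = C□
decode 6 = C◇
decode 7 = DualC
decode 8 = K□
decode 9 = K◇
decode 10 = DualK
decode 11 = T□
decode 12 = T◇
decode 13 = P□
decode 14 = P◇
decode 15 = Dr
decode 16 = D□
decode 17 = CD
decode _ = CD□

decode-code : ∀ r → decode (code r) ≡ r
decode-code M□ = refl
decode-code M◇ = refl
decode-code DualM = refl
decode-code N□ = refl
decode-code N◇ = refl
decode-code C□ = refl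
decode-code C◇ = refl
decode-code DualC = refl
decode-code K□ = refl
decode-code K◇ = refl
decode-code DualK = refl
decode-code T□ = refl
decode-code T◇ = refl
decode-code P□ = refl
decode-code P◇ = refl
decode-code Dr = refl
decode-code D□ = refl
decode-code CD = refl
decode-code CD□ = refl

_≟ᴿ_ : DecidableEquality MRule
r ≟ᴿ s = map′ code-injective (cong code) (code r ℕ.≟ code s)
  where
  code-injective : code r ≡ code s → r ≡ s
  code-injective e = trans (sym (decode-code r)) (trans (cong decode e) (decode-code s))

open import Data.List.Membership.DecPropositional _≟ᴿ_ using (_∈?_)

has? : ∀ L r → Dec (Has L r)
has? L r = r ∈? rulesOf L

calculi : List Calc
calculi = WM ∷ WMP ∷ WMN ∷ WMNP ∷ WMC ∷ WK ∷ WMD ∷ WMND ∷ WMCD ∷ WKD ∷ WMT ∷ WMNT ∷ WMCT ∷ WKT ∷ []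

all-calculi : ∀ {P : Calc → Set} → All P calculi → ∀ L → P L
all-calculi (p ∷ _) WM = p
all-calculi (_ ∷ p ∷ _) WMP = p
all-calculi (_ ∷ _ ∷ p ∷ _) WMN = p
all-calculi (_ ∷ _ ∷ _ ∷ p ∷ _) WMNP = p
all-calculi (_ ∷ _ ∷ _ ∷ _ ∷ p ∷ _) WMC = p
all-calculi (_ ∷ _ ∷ _ ∷ _ ∷ _ ∷ p ∷ _) WK = p
all-calculi (_ ∷ _ ∷ _ ∷ _ ∷ _ ∷ _ ∷ p ∷ _) WMD = p
all-calculi (_ ∷ _ ∷ _ ∷ _ ∷ _ ∷ _ ∷ _ ∷ p ∷ _) WMND = p
all-calculi (_ ∷ _ ∷ _ ∷ _ ∷ _ ∷ _ ∷ _ ∷ _ ∷ p ∷ _) WMCD = p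
all-calculi (_ ∷ _ ∷ _ ∷ _ ∷ _ ∷ _ ∷ _ ∷ _ ∷ _ ∷ p ∷ _) WKD = p
all-calculi (_ ∷ _ ∷ _ ∷ _ ∷ _ ∷ _ ∷ _ ∷ _ ∷ _ ∷ _ ∷ p ∷ _) WMT = p
all-calculi (_ ∷ _ ∷ _ ∷ _ ∷ _ ∷ _ ∷ _ ∷ _ ∷ _ ∷ _ ∷ _ ∷ p ∷ _) WMNT = p
all-calculi (_ ∷ _ ∷ _ ∷ _ ∷ _ ∷ _ ∷ _ ∷ _ ∷ _ ∷ _ ∷ _ ∷ _ ∷ p ∷ _) WMCT = p
all-calculi (_ ∷ _ ∷ _ ∷ _ ∷ _ ∷ _ ∷ _ ∷ _ ∷ _ ∷ _ ∷ _ ∷ _ ∷ _ ∷ p ∷ _) WKT = p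

-- The implicit argument is discharged by evaluation on the rule sets of all fourteen calculi.
has-⇒ : ∀ r s {_ : True (all? (λ L → has? L r →-dec has? L s) calculi)} →
        ∀ {L} → Has L r → Has L s
has-⇒ r s {t} {L} = all-calculi (toWitness t) L

has-exclusive : ∀ r s {_ : True (all? (λ L → ¬? (has? L r ×-dec has? L s)) calculi)} →
                ∀ {L} → Has L r → Has L s → ⊥
has-exclusive r s {t} {L} hr hs = all-calculi (toWitness t) L (hr , hs)


module _ {A : Set} where

  ∈⇒↭∷ : ∀ {x : A} {xs} → x ∈ xs → ∃ λ zs → xs ↭ x ∷ zs
  ∈⇒↭∷ {x} x∈xs with ys , zs , refl ← ∈-∃++ x∈xs = ys ++ zs , shift x ys zs

  ∷-↭-∷-inv : ∀ {x y : A} {xs ys} → x ∷ xs ↭ y ∷ ys →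
              (x ≡ y × xs ↭ ys) ⊎ (∃ λ zs → xs ↭ y ∷ zs × ys ↭ x ∷ zs)
  ∷-↭-∷-inv {x} {y} p with ∈-resp-↭ (↭-sym p) (here refl)
  ... | here refl = inj₁ (refl , drop-∷ p)
  ... | there y∈xs with zs , q ← ∈⇒↭∷ y∈xs =
    inj₂ (zs , q , drop-∷ (↭-trans (↭-sym p) (↭-trans (prep x q) (swap x y ↭-refl))))

  ∷-↭-∷∷-inv : ∀ {x y : A} {xs ys} → y ∷ xs ↭ x ∷ x ∷ ys →
               (y ≡ x × xs ↭ x ∷ ys) ⊎ (∃ λ zs → xs ↭ x ∷ x ∷ zs × ys ↭ y ∷ zs)
  ∷-↭-∷∷-inv {x} p with ∷-↭-∷-inv p
  ... | inj₁ r = inj₁ r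
  ... | inj₂ (zs , q , r) with ∷-↭-∷-inv (↭-sym r)
  ...   | inj₁ (eq , s) = inj₁ (eq , ↭-trans q (prep x s))
  ...   | inj₂ (ws , s , t) = inj₂ (ws , ↭-trans q (prep x s) , t)

  ++-↭-∷-inv : ∀ {y : A} xs ys {zs} → xs ++ ys ↭ y ∷ zs →
               (∃ λ ws → xs ↭ y ∷ ws × zs ↭ ws ++ ys) ⊎ (∃ λ ws → ys ↭ y ∷ ws × zs ↭ xs ++ ws)
  ++-↭-∷-inv {y} xs ys p with ∈-++⁻ xs (∈-resp-↭ (↭-sym p) (here refl))
  ... | inj₁ y∈xs with ws , q ← ∈⇒↭∷ y∈xs =
    inj₁ (ws , q , drop-∷ (↭-trans (↭-sym p) (++⁺ʳ ys q)))
  ... | inj₂ y∈ys with ws , q ← ∈⇒↭∷ y∈ys =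
    inj₂ (ws , q , drop-∷ (↭-trans (↭-sym p) (↭-trans (++⁺ˡ xs q) (shift y xs ws))))

  map-↭-∷-inv : ∀ {B : Set} (f : B → A) xs {y ys} → map f xs ↭ y ∷ ys →
                ∃ λ x → ∃ λ xs′ → y ≡ f x × xs ↭ x ∷ xs′ × ys ≡ map f xs′
  map-↭-∷-inv f xs p with x ∷ xs′ , refl , q ← ↭-map-inv f p = x , xs′ , refl , q , refl

  ↭-under : ∀ zs ys {xs ws : List A} → xs ↭ ys ++ ws → zs ++ xs ↭ ys ++ zs ++ ws
  ↭-under zs ys p = ↭-trans (++⁺ˡ zs p) (shifts zs ys)

  singleton-↭-∷∷ : ∀ {a x : A} {xs} → a ∷ [] ↭ x ∷ x ∷ xs → ⊥
  singleton-↭-∷∷ p with () ← ↭-length p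

  pair-↭-∷∷ : ∀ {a b x : A} {xs} → a ∷ b ∷ [] ↭ x ∷ x ∷ xs → a ≡ x × b ≡ x
  pair-↭-∷∷ {xs = _ ∷ _} p with () ← ↭-length p
  pair-↭-∷∷ {xs = []} p = both (∈-resp-↭ p (here refl)) , both (∈-resp-↭ p (there (here refl)))
    where
    both : ∀ {a x : A} → a ∈ x ∷ x ∷ [] → a ≡ x
    both (here eq) = eq
    both (there (here eq)) = eq

□ₗ-↭-∷∷-inv : ∀ {X : Fm} xs {ys} → □ₗ xs ↭ X ∷ X ∷ ys →
              ∃ λ X₀ → ∃ λ xs′ → X ≡ □ X₀ × xs ↭ X₀ ∷ X₀ ∷ xs′ × ys ≡ □ₗ xs′
□ₗ-↭-∷∷-inv xs p with X₀ ∷ .X₀ ∷ xs′ , refl , q ← ↭-map-inv □ p = X₀ , xs′ , refl , q , refl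

□ₗ-++ : ∀ xs ys → □ₗ (xs ++ ys) ↭ □ₗ xs ++ □ₗ ys
□ₗ-++ xs ys = ↭-reflexive (map-++ □ xs ys)

-- Weakening and rearranging antecedents

exchange : ∀ {L X Y Γ Δ} → L ⊢ X ∷ Y ∷ Γ ⇒ Δ → L ⊢ Y ∷ X ∷ Γ ⇒ Δ
exchange = perm (swap _ _ ↭-refl)

weaken : ∀ {L Γ Δ} X → L ⊢ Γ ⇒ Δ → L ⊢ X ∷ Γ ⇒ Δ
weaken X (perm p d) = perm (prep X p) (weaken X d)
weaken X init = exchange init
weaken X L⊥ = exchange L⊥
weaken X (L⊃ d e) = exchange (L⊃ (exchange (weaken X d)) (exchange (weaken X e)))
weaken X (R⊃ d) = R⊃ (exchange (weaken X d))
weaken X (R∧ d e) = R∧ (weaken X d) (weaken X e)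
weaken X (L∧ d) = exchange (L∧ (perm (shifts [ X ] (_ ∷ _ ∷ [])) (weaken X d)))
weaken X (R∨₁ d) = R∨₁ (weaken X d)
weaken X (R∨₂ d) = R∨₂ (weaken X d)
weaken X (L∨ d e) = exchange (L∨ (exchange (weaken X d)) (exchange (weaken X e)))
weaken X (rM□ h d) = exchange (rM□ h d)
weaken X (rM◇ h d) = exchange (rM◇ h d)
weaken X (rDualM h d) = perm (shifts (_ ∷ _ ∷ []) [ X ]) (rDualM h d)
weaken X (rN□ h d) = rN□ h d
weaken X (rN◇ h d) = exchange (rN◇ h d)
weaken X (rC□ h {Γ} {Γ'} d) = rC□ h {Γ} {X ∷ Γ'} d
weaken X (rC◇ h {Γ} {Γ'} d) = rC◇ h {Γ} {X ∷ Γ'} d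
weaken X (rDualC h {Γ} {Γ'} d) = rDualC h {Γ} {X ∷ Γ'} d
weaken X (rK□ h {Γ} {Γ'} d) = rK□ h {Γ} {X ∷ Γ'} d
weaken X (rK◇ h {Γ} {Γ'} d) = rK◇ h {Γ} {X ∷ Γ'} d
weaken X (rDualK h {Γ} {Γ'} d) = rDualK h {Γ} {X ∷ Γ'} d
weaken X (rT□ h d) = exchange (rT□ h (perm (shifts [ X ] (_ ∷ _ ∷ [])) (weaken X d)))
weaken X (rT◇ h d) = rT◇ h (weaken X d)
weaken X (rP□ h d) = exchange (rP□ h d)
weaken X (rP◇ h d) = rP◇ h d
weaken X (rD h d) = exchange (rD h d)
weaken X (rD□ h d) = perm (shifts (_ ∷ _ ∷ []) [ X ]) (rD□ h d)
weaken X (rCD h {Γ} {Γ'} d) = rCD h {Γ} {X ∷ Γ'} d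
weaken X (rCD□ h {Γ} {Γ'} d) = rCD□ h {Γ} {X ∷ Γ'} d

weakenˡ : ∀ {L Γ Δ} Θ → L ⊢ Γ ⇒ Δ → L ⊢ Θ ++ Γ ⇒ Δ
weakenˡ [] d = d
weakenˡ (X ∷ Θ) d = weaken X (weakenˡ Θ d)

weakenʳ : ∀ {L Γ Δ} Θ → L ⊢ Γ ⇒ Δ → L ⊢ Γ ++ Θ ⇒ Δ
weakenʳ {Γ = Γ} Θ d = perm (++-comm Θ Γ) (weakenˡ Θ d)

weaken-succ : ∀ {L Γ Δ} → L ⊢ Γ ⇒ nothing → L ⊢ Γ ⇒ Δ
weaken-succ (perm p d) = perm p (weaken-succ d)
weaken-succ L⊥ = L⊥
weaken-succ (L⊃ d e) = L⊃ d (weaken-succ e)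
weaken-succ (L∧ d) = L∧ (weaken-succ d)
weaken-succ (L∨ d e) = L∨ (weaken-succ d) (weaken-succ e)
weaken-succ (rDualM h d) = rDualM h d
weaken-succ (rN◇ h d) = rN◇ h d
weaken-succ (rDualC h {Γ} {Γ'} d) = rDualC h {Γ} {Γ'} d
weaken-succ (rDualK h {Γ} {Γ'} d) = rDualK h {Γ} {Γ'} d
weaken-succ (rT□ h d) = rT□ h (weaken-succ d)
weaken-succ (rP□ h d) = rP□ h d
weaken-succ (rD□ h d) = rD□ h d
weaken-succ (rCD□ h {Γ} {Γ'} d) = rCD□ h {Γ} {Γ'} d

weaken-empty : ∀ {L Γ Δ} → L ⊢ [] ⇒ nothing → L ⊢ Γ ⇒ Δ
weaken-empty {Γ = Γ} d = weaken-succ (perm (++-identityʳ Γ) (weakenˡ Γ d))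

data Modal : Fm → Set where
  □-modal : ∀ {A} → Modal (□ A)
  ◇-modal : ∀ {A} → Modal (◇ A)

□ₗ-modal : ∀ Q → All Modal (□ₗ Q)
□ₗ-modal [] = []
□ₗ-modal (_ ∷ Q) = □-modal ∷ □ₗ-modal Q

data Compound : Fm → Set where
  ∧-compound : ∀ {A B} → Compound (A ∧' B)
  ∨-compound : ∀ {A B} → Compound (A ∨' B)
  ⊃-compound : ∀ {A B} → Compound (A ⊃ B)

modal⇒¬compound : ∀ {X} → Modal X → ¬ Compound X
modal⇒¬compound □-modal ()
modal⇒¬compound ◇-modal ()

unshift₁ : ∀ {L} Ys {Z zs Δ} → L ⊢ Ys ++ Z ∷ zs ⇒ Δ → L ⊢ Z ∷ Ys ++ zs ⇒ Δ
unshift₁ Ys {Z} {zs} = perm (shift Z Ys zs)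

unshift₂ : ∀ {L} Ys {Z₁ Z₂ zs Δ} → L ⊢ Ys ++ Z₁ ∷ Z₂ ∷ zs ⇒ Δ → L ⊢ Z₁ ∷ Z₂ ∷ Ys ++ zs ⇒ Δ
unshift₂ Ys {Z₁} {Z₂} = perm (shifts Ys (Z₁ ∷ Z₂ ∷ []))

restore₁ : ∀ {L} Ys {Γ X zs Δ} → Γ ↭ X ∷ zs → L ⊢ X ∷ Ys ++ zs ⇒ Δ → L ⊢ Ys ++ Γ ⇒ Δ
restore₁ Ys {X = X} {zs} p = perm (↭-trans (↭-sym (shift X Ys zs)) (++⁺ˡ Ys (↭-sym p)))

restore₂ : ∀ {L} Ys {Γ X₁ X₂ zs Δ} → Γ ↭ X₁ ∷ X₂ ∷ zs → L ⊢ X₁ ∷ X₂ ∷ Ys ++ zs ⇒ Δ → L ⊢ Ys ++ Γ ⇒ Δ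
restore₂ Ys {X₁ = X₁} {X₂} p = perm (↭-trans (↭-sym (shifts Ys (X₁ ∷ X₂ ∷ []))) (++⁺ˡ Ys (↭-sym p)))

-- Y is either among the formulas P of a rule instance with arbitrary weakening context,
-- or it lies in that context and can be traded for any Ys.
replace-weakened : ∀ {L Y Γ Δ} Ys P Σ → P ++ Σ ↭ Y ∷ Γ → (∀ Θ → L ⊢ P ++ Θ ⇒ Δ) →
                   (∃ λ ws → P ↭ Y ∷ ws × Γ ↭ ws ++ Σ) ⊎ L ⊢ Ys ++ Γ ⇒ Δ
replace-weakened Ys P Σ q rule with ++-↭-∷-inv P Σ q
... | inj₁ located = inj₁ located
... | inj₂ (ws , _ , r) = inj₂ (perm (↭-trans (shifts P Ys) (++⁺ˡ Ys (↭-sym r))) (rule (Ys ++ ws)))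

replace-weakenedʳ : ∀ {L Y Γ Δ} Ys Σ P → Σ ++ P ↭ Y ∷ Γ → (∀ Θ → L ⊢ Θ ++ P ⇒ Δ) →
                    (∃ λ ws → P ↭ Y ∷ ws × Γ ↭ ws ++ Σ) ⊎ L ⊢ Ys ++ Γ ⇒ Δ
replace-weakenedʳ Ys Σ P q rule =
  replace-weakened Ys P Σ (↭-trans (++-comm P Σ) q) (λ Θ → perm (++-comm Θ P) (rule Θ))

-- Invertibility of the left rules

module LeftInversion {L : Calc} {Y : Fm} (Y-compound : Compound Y) (Ys : Ctx)
  (⊃-case : ∀ {B C Σ Δ} → (B ⊃ C) ≡ Y → L ⊢ (B ⊃ C) ∷ Σ ⇒ just B → L ⊢ C ∷ Σ ⇒ Δ → L ⊢ Ys ++ Σ ⇒ Δ)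
  (∧-case : ∀ {B C Σ Δ} → (B ∧' C) ≡ Y → L ⊢ B ∷ C ∷ Σ ⇒ Δ → L ⊢ Ys ++ Σ ⇒ Δ)
  (∨-case : ∀ {B C Σ Δ} → (B ∨' C) ≡ Y → L ⊢ B ∷ Σ ⇒ Δ → L ⊢ C ∷ Σ ⇒ Δ → L ⊢ Ys ++ Σ ⇒ Δ)
  where

  not-principal : ∀ {X} → ¬ Compound X → X ≡ Y → ⊥
  not-principal ¬c refl = ¬c Y-compound

  not-in-modal : ∀ {P ws} → All Modal P → P ↭ Y ∷ ws → ⊥
  not-in-modal M p = modal⇒¬compound (lookup M (∈-resp-↭ (↭-sym p) (here refl))) Y-compound

  modal-rule : ∀ {Γ Δ} P Σ → All Modal P → P ++ Σ ↭ Y ∷ Γ → (∀ Θ → L ⊢ P ++ Θ ⇒ Δ) → L ⊢ Ys ++ Γ ⇒ Δ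
  modal-rule P Σ M q rule with replace-weakened Ys P Σ q rule
  ... | inj₁ (_ , p , _) = ⊥-elim (not-in-modal M p)
  ... | inj₂ d = d

  modal-ruleʳ : ∀ {Γ Δ} Σ P → All Modal P → Σ ++ P ↭ Y ∷ Γ → (∀ Θ → L ⊢ Θ ++ P ⇒ Δ) → L ⊢ Ys ++ Γ ⇒ Δ
  modal-ruleʳ Σ P M q rule with replace-weakenedʳ Ys Σ P q rule
  ... | inj₁ (_ , p , _) = ⊥-elim (not-in-modal M p)
  ... | inj₂ d = d

  invert : ∀ {Π Γ Δ} → L ⊢ Π ⇒ Δ → Π ↭ Y ∷ Γ → L ⊢ Ys ++ Γ ⇒ Δ
  invert (perm p d) q = invert d (↭-trans p q)
  invert init q with ∷-↭-∷-inv q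
  ... | inj₁ (eq , _) = ⊥-elim (not-principal (λ ()) eq)
  ... | inj₂ (_ , _ , p) = restore₁ Ys p init
  invert L⊥ q with ∷-↭-∷-inv q
  ... | inj₁ (eq , _) = ⊥-elim (not-principal (λ ()) eq)
  ... | inj₂ (_ , _ , p) = restore₁ Ys p L⊥
  invert (L⊃ d e) q with ∷-↭-∷-inv q
  ... | inj₁ (eq , p) = perm (++⁺ˡ Ys p) (⊃-case eq d e)
  ... | inj₂ (_ , p₁ , p₂) =
    restore₁ Ys p₂
      (L⊃ (unshift₁ Ys (invert d (↭-under [ _ ] [ _ ] p₁))) (unshift₁ Ys (invert e (↭-under [ _ ] [ _ ] p₁))))
  invert (R⊃ d) q = R⊃ (unshift₁ Ys (invert d (↭-under [ _ ] [ _ ] q)))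
  invert (R∧ d e) q = R∧ (invert d q) (invert e q)
  invert (L∧ d) q with ∷-↭-∷-inv q
  ... | inj₁ (eq , p) = perm (++⁺ˡ Ys p) (∧-case eq d)
  ... | inj₂ (_ , p₁ , p₂) = restore₁ Ys p₂ (L∧ (unshift₂ Ys (invert d (↭-under (_ ∷ _ ∷ []) [ _ ] p₁))))
  invert (R∨₁ d) q = R∨₁ (invert d q)
  invert (R∨₂ d) q = R∨₂ (invert d q)
  invert (L∨ d e) q with ∷-↭-∷-inv q
  ... | inj₁ (eq , p) = perm (++⁺ˡ Ys p) (∨-case eq d e)
  ... | inj₂ (_ , p₁ , p₂) =
    restore₁ Ys p₂
      (L∨ (unshift₁ Ys (invert d (↭-under [ _ ] [ _ ] p₁))) (unshift₁ Ys (invert e (↭-under [ _ ] [ _ ] p₁))))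
  invert (rM□ h d) q = modal-rule [ _ ] _ (□-modal ∷ []) q (λ _ → rM□ h d)
  invert (rM◇ h d) q = modal-rule [ _ ] _ (◇-modal ∷ []) q (λ _ → rM◇ h d)
  invert (rDualM h d) q = modal-rule (_ ∷ _ ∷ []) _ (□-modal ∷ ◇-modal ∷ []) q (λ _ → rDualM h d)
  invert (rN□ h d) q = rN□ h d
  invert (rN◇ h d) q = modal-rule [ _ ] _ (◇-modal ∷ []) q (λ _ → rN◇ h d)
  invert (rC□ h {Γ₀} {Γ'} d) q =
    modal-ruleʳ Γ' _ (All-++⁺ (□ₗ-modal Γ₀) (□-modal ∷ [])) q (λ Θ → rC□ h {Γ₀} {Θ} d)
  invert (rC◇ h {Γ₀} {Γ'} d) q =
    modal-ruleʳ Γ' _ (All-++⁺ (□ₗ-modal Γ₀) (◇-modal ∷ [])) q (λ Θ → rC◇ h {Γ₀} {Θ} d)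
  invert (rDualC h {Γ₀} {Γ'} d) q =
    modal-ruleʳ Γ' _ (All-++⁺ (□ₗ-modal Γ₀) (□-modal ∷ ◇-modal ∷ [])) q (λ Θ → rDualC h {Γ₀} {Θ} d)
  invert (rK□ h {Γ₀} {Γ'} d) q = modal-ruleʳ Γ' _ (□ₗ-modal Γ₀) q (λ Θ → rK□ h {Γ₀} {Θ} d)
  invert (rK◇ h {Γ₀} {Γ'} d) q =
    modal-ruleʳ Γ' _ (All-++⁺ (□ₗ-modal Γ₀) (◇-modal ∷ [])) q (λ Θ → rK◇ h {Γ₀} {Θ} d)
  invert (rDualK h {Γ₀} {Γ'} d) q =
    modal-ruleʳ Γ' _ (All-++⁺ (□ₗ-modal Γ₀) (◇-modal ∷ [])) q (λ Θ → rDualK h {Γ₀} {Θ} d)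
  invert (rT□ h d) q with ∷-↭-∷-inv q
  ... | inj₁ (eq , _) = ⊥-elim (not-principal (λ ()) eq)
  ... | inj₂ (_ , p₁ , p₂) = restore₁ Ys p₂ (rT□ h (unshift₂ Ys (invert d (↭-under (_ ∷ _ ∷ []) [ _ ] p₁))))
  invert (rT◇ h d) q = rT◇ h (invert d q)
  invert (rP□ h d) q = modal-rule [ _ ] _ (□-modal ∷ []) q (λ _ → rP□ h d)
  invert (rP◇ h d) q = rP◇ h d
  invert (rD h d) q = modal-rule [ _ ] _ (□-modal ∷ []) q (λ _ → rD h d)
  invert (rD□ h d) q = modal-rule (_ ∷ _ ∷ []) _ (□-modal ∷ □-modal ∷ []) q (λ _ → rD□ h d)
  invert (rCD h {Γ₀} {Γ'} d) q = modal-ruleʳ Γ' _ (□ₗ-modal Γ₀) q (λ Θ → rCD h {Γ₀} {Θ} d)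
  invert (rCD□ h {Γ₀} {Γ'} d) q = modal-ruleʳ Γ' _ (□ₗ-modal Γ₀) q (λ Θ → rCD□ h {Γ₀} {Θ} d)

L∧-inv : ∀ {L B C Π Γ Δ} → L ⊢ Π ⇒ Δ → Π ↭ (B ∧' C) ∷ Γ → L ⊢ B ∷ C ∷ Γ ⇒ Δ
L∧-inv {B = B} {C} = LeftInversion.invert ∧-compound (B ∷ C ∷ []) (λ ()) (λ { refl d → d }) (λ ())

L∨-invˡ : ∀ {L B C Π Γ Δ} → L ⊢ Π ⇒ Δ → Π ↭ (B ∨' C) ∷ Γ → L ⊢ B ∷ Γ ⇒ Δ
L∨-invˡ {B = B} = LeftInversion.invert ∨-compound [ B ] (λ ()) (λ ()) (λ { refl d _ → d })

L∨-invʳ : ∀ {L B C Π Γ Δ} → L ⊢ Π ⇒ Δ → Π ↭ (B ∨' C) ∷ Γ → L ⊢ C ∷ Γ ⇒ Δ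
L∨-invʳ {C = C} = LeftInversion.invert ∨-compound [ C ] (λ ()) (λ ()) (λ { refl _ e → e })

L⊃-invʳ : ∀ {L B C Π Γ Δ} → L ⊢ Π ⇒ Δ → Π ↭ (B ⊃ C) ∷ Γ → L ⊢ C ∷ Γ ⇒ Δ
L⊃-invʳ {C = C} = LeftInversion.invert ⊃-compound [ C ] (λ { refl _ e → e }) (λ ()) (λ ())

-- Contraction

contract-weakened : ∀ {L X Γ Δ} P Σ → P ++ Σ ↭ X ∷ X ∷ Γ → (∀ Θ → L ⊢ P ++ Θ ⇒ Δ) →
                    (∃ λ ws → P ↭ X ∷ X ∷ ws × Γ ↭ ws ++ Σ) ⊎ L ⊢ X ∷ Γ ⇒ Δ
contract-weakened {X = X} P Σ q rule with ++-↭-∷-inv P Σ q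
... | inj₂ (zs , _ , r) = inj₂ (perm (↭-sym r) (rule zs))
... | inj₁ (zs , p , r) with ++-↭-∷-inv zs Σ (↭-sym r)
...   | inj₁ (ws , s , t) = inj₁ (ws , ↭-trans p (prep X s) , t)
...   | inj₂ (ws , _ , t) = inj₂ (perm (↭-trans (++⁺ʳ ws p) (prep X (↭-sym t))) (rule ws))

contract-weakenedʳ : ∀ {L X Γ Δ} Σ P → Σ ++ P ↭ X ∷ X ∷ Γ → (∀ Θ → L ⊢ Θ ++ P ⇒ Δ) →
                     (∃ λ ws → P ↭ X ∷ X ∷ ws × Γ ↭ ws ++ Σ) ⊎ L ⊢ X ∷ Γ ⇒ Δ
contract-weakenedʳ Σ P q rule =
  contract-weakened P Σ (↭-trans (++-comm P Σ) q) (λ Θ → perm (++-comm Θ P) (rule Θ))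

□ₗ◇-↭-∷∷-inv : ∀ {X A : Fm} Γ₀ {ws} → □ₗ Γ₀ ++ [ ◇ A ] ↭ X ∷ X ∷ ws →
               ∃ λ X₀ → ∃ λ Q₀ → X ≡ □ X₀ × Γ₀ ↭ X₀ ∷ X₀ ∷ Q₀ × ws ↭ ◇ A ∷ □ₗ Q₀
□ₗ◇-↭-∷∷-inv {A = A} Γ₀ p with ∷-↭-∷∷-inv (↭-trans (++-comm [ ◇ A ] (□ₗ Γ₀)) p)
... | inj₁ (refl , r) with _ , _ , () , _ ← map-↭-∷-inv □ Γ₀ r
... | inj₂ (zs , r , s) with X₀ , Q₀ , refl , t , refl ← □ₗ-↭-∷∷-inv Γ₀ r = X₀ , Q₀ , refl , t , s

□-reassemble : ∀ {L X₀ Γ ws Δ} Γ' Q₀ → L ⊢ Γ' ++ □ₗ (X₀ ∷ Q₀) ⇒ Δ → Γ ↭ ws ++ Γ' → ws ≡ □ₗ Q₀ →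
               L ⊢ □ X₀ ∷ Γ ⇒ Δ
□-reassemble {X₀ = X₀} Γ' Q₀ d s refl = perm (↭-trans (++-comm Γ' (□ₗ (X₀ ∷ Q₀))) (prep (□ X₀) (↭-sym s))) d

◇-reassemble : ∀ {L X₀ A Γ ws Δ} Γ' Q₀ → L ⊢ Γ' ++ □ₗ (X₀ ∷ Q₀) ++ [ ◇ A ] ⇒ Δ →
               Γ ↭ ws ++ Γ' → ws ↭ ◇ A ∷ □ₗ Q₀ → L ⊢ □ X₀ ∷ Γ ⇒ Δ
◇-reassemble {X₀ = X₀} {A} Γ' Q₀ d s u =
  perm (↭-trans (regroup Γ' [ □ X₀ ] (□ₗ Q₀) [ ◇ A ]) (prep (□ X₀) (↭-sym (↭-trans s (++⁺ʳ Γ' u))))) d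
  where
  regroup : (g x q a : Ctx) → g ++ (x ++ q) ++ a ↭ x ++ (a ++ q) ++ g
  regroup = solve 4 (λ g x q a → g ⊕ ((x ⊕ q) ⊕ a) ⊜ x ⊕ ((a ⊕ q) ⊕ g)) ↭-refl

single-modal-contract : ∀ {L X Y Σ Γ Δ} → Y ∷ Σ ↭ X ∷ X ∷ Γ → (∀ Θ → L ⊢ Y ∷ Θ ⇒ Δ) → L ⊢ X ∷ Γ ⇒ Δ
single-modal-contract q rule with contract-weakened [ _ ] _ q rule
... | inj₁ (_ , r , _) = ⊥-elim (singleton-↭-∷∷ r)
... | inj₂ d = d

-- Recursive calls are on a subderivation or, in the principal ⊃, ∧, ∨ and modal cases,
-- on a proper subformula of X: the recursion is lexicographic.
contract : ∀ {L} X {Π Γ Δ} → L ⊢ Π ⇒ Δ → Π ↭ X ∷ X ∷ Γ → L ⊢ X ∷ Γ ⇒ Δ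
contract X (perm p d) q = contract X d (↭-trans p q)
contract X init q with ∷-↭-∷∷-inv q
... | inj₁ (refl , _) = init
... | inj₂ (_ , _ , p) = restore₁ [ X ] p init
contract X L⊥ q with ∷-↭-∷∷-inv q
... | inj₁ (refl , _) = L⊥
... | inj₂ (_ , _ , p) = restore₁ [ X ] p L⊥
contract X (L⊃ {A = B} {C} d e) q with ∷-↭-∷∷-inv q
... | inj₁ (refl , p) =
  L⊃ (contract X d (prep X p)) (contract C (L⊃-invʳ e (↭-under [ C ] [ X ] p)) ↭-refl)
... | inj₂ (_ , p₁ , p₂) = restore₁ [ X ] p₂
  (L⊃ (exchange (contract X d (↭-under [ _ ] (X ∷ X ∷ []) p₁)))
      (exchange (contract X e (↭-under [ _ ] (X ∷ X ∷ []) p₁))))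
contract X (R⊃ d) q = R⊃ (exchange (contract X d (↭-under [ _ ] (X ∷ X ∷ []) q)))
contract X (R∧ d e) q = R∧ (contract X d q) (contract X e q)
contract X (L∧ {A = B} {C} d) q with ∷-↭-∷∷-inv q
... | inj₁ (refl , p) =
  let d₁ = L∧-inv d (↭-under (B ∷ C ∷ []) [ X ] p)
      d₂ = contract B d₁ (prep B (swap C B ↭-refl))
  in L∧ (exchange (contract C d₂ (shifts [ B ] (C ∷ C ∷ []))))
... | inj₂ (_ , p₁ , p₂) = restore₁ [ X ] p₂
  (L∧ (perm (shifts [ X ] (_ ∷ _ ∷ [])) (contract X d (↭-under (_ ∷ _ ∷ []) (X ∷ X ∷ []) p₁))))
contract X (R∨₁ d) q = R∨₁ (contract X d q)
contract X (R∨₂ d) q = R∨₂ (contract X d q)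
contract X (L∨ {A = B} {C} d e) q with ∷-↭-∷∷-inv q
... | inj₁ (refl , p) =
  L∨ (contract B (L∨-invˡ d (↭-under [ B ] [ X ] p)) ↭-refl)
     (contract C (L∨-invʳ e (↭-under [ C ] [ X ] p)) ↭-refl)
... | inj₂ (_ , p₁ , p₂) = restore₁ [ X ] p₂
  (L∨ (exchange (contract X d (↭-under [ _ ] (X ∷ X ∷ []) p₁)))
      (exchange (contract X e (↭-under [ _ ] (X ∷ X ∷ []) p₁))))
contract X (rM□ h d) q = single-modal-contract q (λ _ → rM□ h d)
contract X (rM◇ h d) q = single-modal-contract q (λ _ → rM◇ h d)
contract X (rDualM h d) q with contract-weakened (_ ∷ _ ∷ []) _ q (λ _ → rDualM h d)
... | inj₁ (_ , r , _) with refl , () ← pair-↭-∷∷ r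
... | inj₂ d′ = d′
contract X (rN□ h d) q = rN□ h d
contract X (rN◇ h d) q = single-modal-contract q (λ _ → rN◇ h d)
contract X (rC□ h {Γ₀} {Γ'} {A} d) q with contract-weakenedʳ Γ' _ q (λ Θ → rC□ h {Γ₀} {Θ} d)
... | inj₂ d′ = d′
... | inj₁ (_ , r , s)
  with X₀ , Q₀ , refl , t , eq ← □ₗ-↭-∷∷-inv (A ∷ Γ₀) (↭-trans (++-comm [ □ A ] (□ₗ Γ₀)) r) =
  □-reassemble Γ' Q₀ (perm (++⁺ˡ Γ' (++-comm (□ₗ Q₀) [ □ X₀ ])) (rC□ h {Q₀} {Γ'} (contract X₀ d t))) s eq
contract X (rC◇ h {Γ₀} {Γ'} d) q with contract-weakenedʳ Γ' _ q (λ Θ → rC◇ h {Γ₀} {Θ} d)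
... | inj₂ d′ = d′
... | inj₁ (_ , r , s) with X₀ , Q₀ , refl , t , u ← □ₗ◇-↭-∷∷-inv Γ₀ r =
  ◇-reassemble Γ' Q₀ (rC◇ h (exchange (contract X₀ d (↭-under [ _ ] (X₀ ∷ X₀ ∷ []) t)))) s u
contract X (rDualC h {Γ₀} {Γ'} {A} {B} d) q with contract-weakenedʳ Γ' _ q (λ Θ → rDualC h {Γ₀} {Θ} d)
... | inj₂ d′ = d′
... | inj₁ (_ , r , s)
  with X₀ , Q₀ , refl , t , u ← □ₗ◇-↭-∷∷-inv (A ∷ Γ₀) (↭-trans (↭-sym (shift (□ A) (□ₗ Γ₀) _)) r) =
  ◇-reassemble Γ' Q₀
    (perm (++⁺ˡ Γ' (shift (□ X₀) (□ₗ Q₀) _))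
      (rDualC h {Q₀} {Γ'} (contract X₀ d (↭-trans (swap A B ↭-refl) (↭-under [ B ] (X₀ ∷ X₀ ∷ []) t)))))
    s u
contract X (rK□ h {Γ₀} {Γ'} d) q with contract-weakenedʳ Γ' _ q (λ Θ → rK□ h {Γ₀} {Θ} d)
... | inj₂ d′ = d′
... | inj₁ (_ , r , s) with X₀ , Q₀ , refl , t , eq ← □ₗ-↭-∷∷-inv Γ₀ r =
  □-reassemble Γ' Q₀ (rK□ h (contract X₀ d t)) s eq
contract X (rK◇ h {Γ₀} {Γ'} d) q with contract-weakenedʳ Γ' _ q (λ Θ → rK◇ h {Γ₀} {Θ} d)
... | inj₂ d′ = d′
... | inj₁ (_ , r , s) with X₀ , Q₀ , refl , t , u ← □ₗ◇-↭-∷∷-inv Γ₀ r =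
  ◇-reassemble Γ' Q₀ (rK◇ h (exchange (contract X₀ d (↭-under [ _ ] (X₀ ∷ X₀ ∷ []) t)))) s u
contract X (rDualK h {Γ₀} {Γ'} d) q with contract-weakenedʳ Γ' _ q (λ Θ → rDualK h {Γ₀} {Θ} d)
... | inj₂ d′ = d′
... | inj₁ (_ , r , s) with X₀ , Q₀ , refl , t , u ← □ₗ◇-↭-∷∷-inv Γ₀ r =
  ◇-reassemble Γ' Q₀ (rDualK h (exchange (contract X₀ d (↭-under [ _ ] (X₀ ∷ X₀ ∷ []) t)))) s u
contract X (rT□ h {A = A} d) q with ∷-↭-∷∷-inv q
... | inj₁ (refl , p) = rT□ h (contract X d (prep X (↭-under [ A ] [ X ] p)))
... | inj₂ (_ , p₁ , p₂) = restore₁ [ X ] p₂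
  (rT□ h (perm (shifts [ X ] (_ ∷ _ ∷ [])) (contract X d (↭-under (_ ∷ _ ∷ []) (X ∷ X ∷ []) p₁))))
contract X (rT◇ h d) q = rT◇ h (contract X d q)
contract X (rP□ h d) q = single-modal-contract q (λ _ → rP□ h d)
contract X (rP◇ h d) q = rP◇ h d
contract X (rD h d) q = single-modal-contract q (λ _ → rD h d)
contract X (rD□ h {A = A} d) q with contract-weakened (_ ∷ _ ∷ []) _ q (λ _ → rD□ h d)
... | inj₂ d′ = d′
... | inj₁ (_ , r , s) with refl , refl ← pair-↭-∷∷ r =
  perm (prep X (↭-sym s)) (rP□ (has-⇒ D□ P□ h) (contract A d ↭-refl))
contract X (rCD h {Γ₀} {Γ'} d) q with contract-weakenedʳ Γ' _ q (λ Θ → rCD h {Γ₀} {Θ} d)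
... | inj₂ d′ = d′
... | inj₁ (_ , r , s) with X₀ , Q₀ , refl , t , eq ← □ₗ-↭-∷∷-inv Γ₀ r =
  □-reassemble Γ' Q₀ (rCD h (contract X₀ d t)) s eq
contract X (rCD□ h {Γ₀} {Γ'} d) q with contract-weakenedʳ Γ' _ q (λ Θ → rCD□ h {Γ₀} {Θ} d)
... | inj₂ d′ = d′
... | inj₁ (_ , r , s) with X₀ , Q₀ , refl , t , eq ← □ₗ-↭-∷∷-inv Γ₀ r =
  □-reassemble Γ' Q₀ (rCD□ h (contract X₀ d t)) s eq

contract-++ : ∀ {L Δ} Θ {Ψ} → L ⊢ Θ ++ Θ ++ Ψ ⇒ Δ → L ⊢ Θ ++ Ψ ⇒ Δ
contract-++ [] d = d
contract-++ (X ∷ Θ) {Ψ} d =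
  let d₁ = contract X (perm (prep X (shift X Θ (Θ ++ Ψ))) d) ↭-refl
      d₂ = contract-++ Θ (perm (↭-trans (↭-sym (shift X Θ (Θ ++ Ψ))) (++⁺ˡ Θ (↭-sym (shift X Θ Ψ)))) d₁)
  in perm (shift X Θ Ψ) d₂

□ₗ-unbox : ∀ {L Δ} → Has L T□ → ∀ Θ {Ψ} → L ⊢ Θ ++ Ψ ⇒ Δ → L ⊢ □ₗ Θ ++ Ψ ⇒ Δ
□ₗ-unbox h [] d = d
□ₗ-unbox h (X ∷ Θ) {Ψ} d =
  rT□ h (weaken (□ X) (perm (shift X (□ₗ Θ) Ψ) (□ₗ-unbox h Θ (perm (↭-sym (shift X Θ Ψ)) d))))

drop-[]ʳ : ∀ {L Γ Δ} → L ⊢ Γ ++ [] ⇒ Δ → L ⊢ Γ ⇒ Δ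
drop-[]ʳ {Γ = Γ} = perm (++-identityʳ Γ)

-- Cut

data _≺_ : Fm → Fm → Set where
  ⊃ˡ≺ : ∀ {A B} → A ≺ (A ⊃ B)
  ⊃ʳ≺ : ∀ {A B} → B ≺ (A ⊃ B)
  ∧ˡ≺ : ∀ {A B} → A ≺ (A ∧' B)
  ∧ʳ≺ : ∀ {A B} → B ≺ (A ∧' B)
  ∨ˡ≺ : ∀ {A B} → A ≺ (A ∨' B)
  ∨ʳ≺ : ∀ {A B} → B ≺ (A ∨' B)
  □≺ : ∀ {A} → A ≺ □ A
  ◇≺ : ∀ {A} → A ≺ ◇ A

≺-wellFounded : WellFounded _≺_
≺-wellFounded (var _) = acc λ ()
≺-wellFounded ⊥' = acc λ ()
≺-wellFounded (A ∧' B) = acc λ { ∧ˡ≺ → ≺-wellFounded A ; ∧ʳ≺ → ≺-wellFounded B }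
≺-wellFounded (A ∨' B) = acc λ { ∨ˡ≺ → ≺-wellFounded A ; ∨ʳ≺ → ≺-wellFounded B }
≺-wellFounded (A ⊃ B) = acc λ { ⊃ˡ≺ → ≺-wellFounded A ; ⊃ʳ≺ → ≺-wellFounded B }
≺-wellFounded (□ A) = acc λ { □≺ → ≺-wellFounded A }
≺-wellFounded (◇ A) = acc λ { ◇≺ → ≺-wellFounded A }

Cut : Fm → Set
Cut A = ∀ {L Γ Π Γ' Δ} → L ⊢ Γ ⇒ just A → L ⊢ Π ⇒ Δ → Π ↭ A ∷ Γ' → L ⊢ Γ ++ Γ' ⇒ Δ

data RightRule {L : Calc} : ∀ {Γ A} → L ⊢ Γ ⇒ just A → Set where
  by-init : ∀ {Γ p} → RightRule (init {Γ = Γ} {p})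
  by-R⊃ : ∀ {Γ A B} {d : L ⊢ A ∷ Γ ⇒ just B} → RightRule (R⊃ d)
  by-R∧ : ∀ {Γ A B} {d : L ⊢ Γ ⇒ just A} {e : L ⊢ Γ ⇒ just B} → RightRule (R∧ d e)
  by-R∨₁ : ∀ {Γ A B} {d : L ⊢ Γ ⇒ just A} → RightRule (R∨₁ {B = B} d)
  by-R∨₂ : ∀ {Γ A B} {d : L ⊢ Γ ⇒ just B} → RightRule (R∨₂ {A = A} d)
  by-M□ : ∀ {h Γ A B} {d : L ⊢ [ A ] ⇒ just B} → RightRule (rM□ h {Γ} d)
  by-M◇ : ∀ {h Γ A B} {d : L ⊢ [ A ] ⇒ just B} → RightRule (rM◇ h {Γ} d)
  by-N□ : ∀ {h Γ A} {d : L ⊢ [] ⇒ just A} → RightRule (rN□ h {Γ} d)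
  by-C□ : ∀ {h Γ Γ' A B} {d : L ⊢ A ∷ Γ ⇒ just B} → RightRule (rC□ h {Γ} {Γ'} d)
  by-C◇ : ∀ {h Γ Γ' A B} {d : L ⊢ A ∷ Γ ⇒ just B} → RightRule (rC◇ h {Γ} {Γ'} d)
  by-K□ : ∀ {h Γ Γ' A} {d : L ⊢ Γ ⇒ just A} → RightRule (rK□ h {Γ} {Γ'} d)
  by-K◇ : ∀ {h Γ Γ' A B} {d : L ⊢ A ∷ Γ ⇒ just B} → RightRule (rK◇ h {Γ} {Γ'} d)
  by-T◇ : ∀ {h Γ A} {d : L ⊢ Γ ⇒ just A} → RightRule (rT◇ h d)
  by-P◇ : ∀ {h Γ A} {d : L ⊢ [] ⇒ just A} → RightRule (rP◇ h {Γ} d)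
  by-D : ∀ {h Γ A B} {d : L ⊢ [ A ] ⇒ just B} → RightRule (rD h {Γ} d)
  by-CD : ∀ {h Γ Γ' A} {d : L ⊢ Γ ⇒ just A} → RightRule (rCD h {Γ} {Γ'} d)

box-decomposition : ∀ {L Γ A} {D : L ⊢ Γ ⇒ just (□ A)} → RightRule D → ¬ Has L M□ →
                    ∃ λ Γ₀ → ∃ λ Θ → Γ ↭ Γ₀ ++ □ₗ Θ × L ⊢ Θ ⇒ just A
box-decomposition (by-M□ {h}) ¬M = ⊥-elim (¬M h)
box-decomposition (by-N□ {h}) ¬M = ⊥-elim (¬M (has-⇒ N□ M□ h))
box-decomposition (by-C□ {Γ = Γ} {Γ'} {A} {d = d}) _ = Γ' , A ∷ Γ , ++⁺ˡ Γ' (++-comm (□ₗ Γ) [ □ A ]) , d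
box-decomposition (by-K□ {Γ = Γ} {Γ'} {d = d}) _ = Γ' , Γ , ↭-refl , d

□-right-inv : ∀ {L Γ A} {D : L ⊢ Γ ⇒ just (□ A)} → RightRule D → Has L T□ → L ⊢ Γ ⇒ just A
□-right-inv (by-M□ {Γ = Γ} {A} {d = d}) h = □ₗ-unbox h [ A ] (weakenʳ Γ d)
□-right-inv {Γ = Γ} (by-N□ {d = d}) h = weakenʳ Γ d
□-right-inv (by-C□ {Γ = Γ} {Γ'} {A} {d = d}) h =
  perm (↭-trans (++-comm (□ₗ (A ∷ Γ)) Γ') (++⁺ˡ Γ' (++-comm [ □ A ] (□ₗ Γ))))
    (□ₗ-unbox h (A ∷ Γ) (weakenʳ Γ' d))
□-right-inv (by-K□ {Γ = Γ} {Γ'} {d = d}) h = perm (++-comm (□ₗ Γ) Γ') (□ₗ-unbox h Γ (weakenʳ Γ' d))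

∷-□ₗ-↭-∷-inv : ∀ {X A : Fm} Σ {ws} → X ∷ □ₗ Σ ↭ A ∷ ws →
               (A ≡ X × □ₗ Σ ↭ ws) ⊎ (∃ λ A₀ → ∃ λ Q → A ≡ □ A₀ × Σ ↭ A₀ ∷ Q × ws ↭ X ∷ □ₗ Q)
∷-□ₗ-↭-∷-inv Σ p with ∷-↭-∷-inv p
... | inj₁ (refl , q) = inj₁ (refl , q)
... | inj₂ (zs , q , r) with A₀ , Q , refl , t , refl ← map-↭-∷-inv □ Σ q = inj₂ (A₀ , Q , refl , t , r)

append-[] : ∀ {L Δ} Γ Ψ → L ⊢ Γ ++ Ψ ⇒ Δ → L ⊢ Γ ++ Ψ ++ [] ⇒ Δ
append-[] Γ Ψ = perm (++⁺ˡ Γ (↭-sym (++-identityʳ Ψ)))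

regroup-cut : ∀ {L Γ Γ' Δ} Γ₀ Σ' Θ Q R₁ R₂ → Γ ↭ Γ₀ ++ □ₗ Θ ++ R₁ → Γ' ↭ R₂ ++ □ₗ Q ++ Σ' →
              L ⊢ (Γ₀ ++ Σ') ++ □ₗ (Θ ++ Q) ++ R₁ ++ R₂ ⇒ Δ → L ⊢ Γ ++ Γ' ⇒ Δ
regroup-cut Γ₀ Σ' Θ Q R₁ R₂ s t =
  perm (↭-trans (++⁺ˡ (Γ₀ ++ Σ') (++⁺ʳ (R₁ ++ R₂) (□ₗ-++ Θ Q)))
       (↭-trans (regroup Γ₀ Σ' (□ₗ Θ) (□ₗ Q) R₁ R₂) (↭-sym (++⁺ s t))))
  where
  regroup : (g s G Q r₁ r₂ : Ctx) → (g ++ s) ++ (G ++ Q) ++ r₁ ++ r₂ ↭ (g ++ G ++ r₁) ++ r₂ ++ Q ++ s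
  regroup =
    solve 6 (λ g s G Q r₁ r₂ → (g ⊕ s) ⊕ ((G ⊕ Q) ⊕ (r₁ ⊕ r₂)) ⊜ (g ⊕ (G ⊕ r₁)) ⊕ (r₂ ⊕ (Q ⊕ s))) ↭-refl

CutBelow : Fm → Set
CutBelow = WfRec _≺_ Cut

cut-⊃ : ∀ {L Γ Γ' B C Δ} {D : L ⊢ Γ ⇒ just (B ⊃ C)} → CutBelow (B ⊃ C) → RightRule D →
        L ⊢ Γ ++ Γ' ⇒ just B → L ⊢ C ∷ Γ' ⇒ Δ → L ⊢ Γ ++ Γ' ⇒ Δ
cut-⊃ {Γ = Γ} {Γ'} ih (by-R⊃ {d = d}) b c =
  drop-[]ʳ (contract-++ (Γ ++ Γ') (perm regroup (ih ⊃ʳ≺ (ih ⊃ˡ≺ b d ↭-refl) c ↭-refl)))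
  where
  regroup : ((Γ ++ Γ') ++ Γ) ++ Γ' ↭ (Γ ++ Γ') ++ (Γ ++ Γ') ++ []
  regroup = solve 2 (λ a b → ((a ⊕ b) ⊕ a) ⊕ b ⊜ (a ⊕ b) ⊕ ((a ⊕ b) ⊕ ++-Solver.id)) ↭-refl Γ Γ'

cut-∧ : ∀ {L Γ Γ' B C Δ} {D : L ⊢ Γ ⇒ just (B ∧' C)} → CutBelow (B ∧' C) → RightRule D →
        L ⊢ B ∷ C ∷ Γ' ⇒ Δ → L ⊢ Γ ++ Γ' ⇒ Δ
cut-∧ {Γ = Γ} {Γ'} {B} {C} ih (by-R∧ {d = b} {e = c}) e =
  contract-++ Γ (ih ∧ˡ≺ b (ih ∧ʳ≺ c e (swap B C ↭-refl)) (shift B Γ Γ'))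

cut-∨ : ∀ {L Γ Γ' B C Δ} {D : L ⊢ Γ ⇒ just (B ∨' C)} → CutBelow (B ∨' C) → RightRule D →
        L ⊢ B ∷ Γ' ⇒ Δ → L ⊢ C ∷ Γ' ⇒ Δ → L ⊢ Γ ++ Γ' ⇒ Δ
cut-∨ ih (by-R∨₁ {d = b}) e₁ e₂ = ih ∨ˡ≺ b e₁ ↭-refl
cut-∨ ih (by-R∨₂ {d = c}) e₁ e₂ = ih ∨ʳ≺ c e₂ ↭-refl

cut-T□ : ∀ {L Γ Γ' B Δ} {D : L ⊢ Γ ⇒ just (□ B)} → CutBelow (□ B) → RightRule D → Has L T□ →
         L ⊢ Γ ++ B ∷ Γ' ⇒ Δ → L ⊢ Γ ++ Γ' ⇒ Δ
cut-T□ {Γ = Γ} {Γ'} {B} ih r h e = contract-++ Γ (ih □≺ (□-right-inv r h) e (shift B Γ Γ'))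

cut-M□ : ∀ {L Γ Σ B C} {D : L ⊢ Γ ⇒ just (□ B)} → CutBelow (□ B) → RightRule D → Has L M□ →
         L ⊢ [ B ] ⇒ just C → L ⊢ Γ ++ Σ ⇒ just (□ C)
cut-M□ {Σ = Σ} ih (by-M□ {Γ = Γ₀} {d = d}) h e = rM□ h {Γ₀ ++ Σ} (ih □≺ d e ↭-refl)
cut-M□ ih (by-N□ {h = h'} {d = d}) h e = rN□ h' (ih □≺ d e ↭-refl)
cut-M□ ih (by-C□ {h = h'}) h e = ⊥-elim (has-exclusive M□ C□ h h')
cut-M□ ih (by-K□ {h = h'}) h e = ⊥-elim (has-exclusive M□ K□ h h')

cut-P□ : ∀ {L Γ Σ B Δ} {D : L ⊢ Γ ⇒ just (□ B)} → CutBelow (□ B) → RightRule D → Has L P□ →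
         L ⊢ [ B ] ⇒ nothing → L ⊢ Γ ++ Σ ⇒ Δ
cut-P□ {Σ = Σ} ih (by-M□ {Γ = Γ₀} {d = d}) h e = rP□ h {Γ₀ ++ Σ} (ih □≺ d e ↭-refl)
cut-P□ ih (by-N□ {d = d}) h e = weaken-empty (ih □≺ d e ↭-refl)
cut-P□ ih (by-C□ {h = h'}) h e = ⊥-elim (has-exclusive P□ C□ h h')
cut-P□ ih (by-K□ {h = h'}) h e = ⊥-elim (has-exclusive P□ K□ h h')

cut-D : ∀ {L Γ Σ B C} {D : L ⊢ Γ ⇒ just (□ B)} → CutBelow (□ B) → RightRule D → Has L Dr →
        L ⊢ [ B ] ⇒ just C → L ⊢ Γ ++ Σ ⇒ just (◇ C)
cut-D {Σ = Σ} ih (by-M□ {Γ = Γ₀} {d = d}) h e = rD h {Γ₀ ++ Σ} (ih □≺ d e ↭-refl)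
cut-D ih (by-N□ {d = d}) h e = rP◇ (has-⇒ Dr P◇ h) (ih □≺ d e ↭-refl)
cut-D ih (by-C□ {h = h'}) h e = ⊥-elim (has-exclusive Dr C□ h h')
cut-D ih (by-K□ {h = h'}) h e = ⊥-elim (has-exclusive Dr K□ h h')

cut-D□ : ∀ {L Γ Σ B C Δ} {D : L ⊢ Γ ⇒ just (□ B)} → CutBelow (□ B) → RightRule D → Has L D□ →
         L ⊢ B ∷ C ∷ [] ⇒ nothing → L ⊢ Γ ++ □ C ∷ Σ ⇒ Δ
cut-D□ {Σ = Σ} {C = C} ih (by-M□ {Γ = Γ₀} {d = d}) h e =
  perm (prep _ (↭-sym (shift (□ C) Γ₀ Σ))) (rD□ h {Γ₀ ++ Σ} (ih □≺ d e ↭-refl))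
cut-D□ {Γ = Γ} {Σ} {C = C} ih (by-N□ {d = d}) h e =
  perm (↭-sym (shift (□ C) Γ Σ)) (rP□ (has-⇒ D□ P□ h) {Γ ++ Σ} (ih □≺ d e ↭-refl))
cut-D□ ih (by-C□ {h = h'}) h e = ⊥-elim (has-exclusive D□ C□ h h')
cut-D□ ih (by-K□ {h = h'}) h e = ⊥-elim (has-exclusive D□ K□ h h')

regroup-cut₀ : ∀ {L Γ Γ' Δ} Γ₀ Σ' Θ Q → Γ ↭ Γ₀ ++ □ₗ Θ → Γ' ↭ □ₗ Q ++ Σ' →
               L ⊢ (Γ₀ ++ Σ') ++ □ₗ (Θ ++ Q) ⇒ Δ → L ⊢ Γ ++ Γ' ⇒ Δ
regroup-cut₀ Γ₀ Σ' Θ Q s t d =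
  regroup-cut Γ₀ Σ' Θ Q [] [] (↭-trans s (↭-sym (++⁺ˡ Γ₀ (++-identityʳ (□ₗ Θ))))) t (append-[] (Γ₀ ++ Σ') _ d)

□ₗ-unboxʳ : ∀ {L Γ Δ} → Has L T□ → ∀ Σ Σ' → L ⊢ Γ ++ Σ ⇒ Δ → L ⊢ Γ ++ □ₗ Σ ++ Σ' ⇒ Δ
□ₗ-unboxʳ {Γ = Γ} h Σ Σ' d =
  perm (regroup Σ' (□ₗ Σ) Γ) (weakenˡ Σ' (□ₗ-unbox h Σ (perm (++-comm Γ Σ) d)))
  where
  regroup : (a b c : Ctx) → a ++ b ++ c ↭ c ++ b ++ a
  regroup = solve 3 (λ a b c → a ⊕ (b ⊕ c) ⊜ c ⊕ (b ⊕ a)) ↭-refl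

cut-M◇ : ∀ {L Γ Σ B C} {D : L ⊢ Γ ⇒ just (◇ B)} → CutBelow (◇ B) → RightRule D → Has L M◇ →
         L ⊢ [ B ] ⇒ just C → L ⊢ Γ ++ Σ ⇒ just (◇ C)
cut-M◇ {Σ = Σ} ih (by-M◇ {Γ = Γ₀} {d = d}) h e = rM◇ h {Γ₀ ++ Σ} (ih ◇≺ d e ↭-refl)
cut-M◇ {Σ = Σ} ih (by-T◇ {h = h'} {d = d}) h e = weakenʳ Σ (rT◇ h' (drop-[]ʳ (ih ◇≺ d e ↭-refl)))
cut-M◇ ih (by-P◇ {h = h'} {d = d}) h e = rP◇ h' (ih ◇≺ d e ↭-refl)
cut-M◇ {Σ = Σ} ih (by-D {h = h'} {Γ = Γ₀} {d = d}) h e = rD h' {Γ₀ ++ Σ} (ih ◇≺ d e ↭-refl)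
cut-M◇ ih (by-C◇ {h = h'}) h e = ⊥-elim (has-exclusive M◇ C◇ h h')
cut-M◇ ih (by-K◇ {h = h'}) h e = ⊥-elim (has-exclusive M◇ K◇ h h')
cut-M◇ ih (by-CD {h = h'}) h e = ⊥-elim (has-exclusive M◇ CD h h')

cut-N◇ : ∀ {L Γ Σ B Δ} {D : L ⊢ Γ ⇒ just (◇ B)} → CutBelow (◇ B) → RightRule D → Has L N◇ →
         L ⊢ [ B ] ⇒ nothing → L ⊢ Γ ++ Σ ⇒ Δ
cut-N◇ {Σ = Σ} ih (by-M◇ {Γ = Γ₀} {d = d}) h e = rN◇ h {Γ₀ ++ Σ} (ih ◇≺ d e ↭-refl)
cut-N◇ {Σ = Σ} ih (by-T◇ {d = d}) h e = weaken-succ (weakenʳ Σ (drop-[]ʳ (ih ◇≺ d e ↭-refl)))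
cut-N◇ ih (by-P◇ {d = d}) h e = weaken-empty (ih ◇≺ d e ↭-refl)
cut-N◇ {Σ = Σ} ih (by-D {h = h'} {Γ = Γ₀} {d = d}) h e = rP□ (has-⇒ Dr P□ h') {Γ₀ ++ Σ} (ih ◇≺ d e ↭-refl)
cut-N◇ ih (by-C◇ {h = h'}) h e = ⊥-elim (has-exclusive N◇ C◇ h h')
cut-N◇ ih (by-K◇ {h = h'}) h e = ⊥-elim (has-exclusive N◇ K◇ h h')
cut-N◇ ih (by-CD {h = h'}) h e = ⊥-elim (has-exclusive N◇ CD h h')

cut-DualM-□ : ∀ {L Γ Σ B C Δ} {D : L ⊢ Γ ⇒ just (□ B)} → CutBelow (□ B) → RightRule D → Has L DualM →
              L ⊢ B ∷ C ∷ [] ⇒ nothing → L ⊢ Γ ++ ◇ C ∷ Σ ⇒ Δ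
cut-DualM-□ {Σ = Σ} {C = C} ih (by-M□ {Γ = Γ₀} {d = d}) h e =
  perm (prep _ (↭-sym (shift (◇ C) Γ₀ Σ))) (rDualM h {Γ₀ ++ Σ} (ih □≺ d e ↭-refl))
cut-DualM-□ {Γ = Γ} {Σ} {C = C} ih (by-N□ {h = h'} {d = d}) h e =
  perm (↭-sym (shift (◇ C) Γ Σ)) (rN◇ (has-⇒ N□ N◇ h') {Γ ++ Σ} (ih □≺ d e ↭-refl))
cut-DualM-□ ih (by-C□ {h = h'}) h e = ⊥-elim (has-exclusive DualM C□ h h')
cut-DualM-□ ih (by-K□ {h = h'}) h e = ⊥-elim (has-exclusive DualM K□ h h')

cut-DualM-◇ : ∀ {L Γ Σ B C Δ} {D : L ⊢ Γ ⇒ just (◇ C)} → CutBelow (◇ C) → RightRule D → Has L DualM →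
              L ⊢ B ∷ C ∷ [] ⇒ nothing → L ⊢ Γ ++ □ B ∷ Σ ⇒ Δ
cut-DualM-◇ {Σ = Σ} {B} {C} ih (by-M◇ {Γ = Γ₀} {d = d}) h e =
  perm (↭-trans (swap _ _ ↭-refl) (prep _ (↭-sym (shift (□ B) Γ₀ Σ))))
       (rDualM h {Γ₀ ++ Σ} (exchange (ih ◇≺ d e (swap B C ↭-refl))))
cut-DualM-◇ {Γ = Γ} {Σ} {B} {C} ih (by-T◇ {h = h'} {d = d}) h e =
  perm (↭-sym (shift (□ B) Γ Σ)) (weaken-succ (weakenʳ Σ
    (rT□ (has-⇒ T◇ T□ h') (weaken (□ B) (perm (++-comm Γ [ B ]) (ih ◇≺ d e (swap B C ↭-refl)))))))
cut-DualM-◇ {Γ = Γ} {Σ} {B} {C} ih (by-P◇ {h = h'} {d = d}) h e =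
  perm (↭-sym (shift (□ B) Γ Σ)) (rP□ (has-⇒ P◇ P□ h') {Γ ++ Σ} (ih ◇≺ d e (swap B C ↭-refl)))
cut-DualM-◇ {Σ = Σ} {B} {C} ih (by-D {h = h'} {Γ = Γ₀} {d = d}) h e =
  perm (↭-trans (swap _ _ ↭-refl) (prep _ (↭-sym (shift (□ B) Γ₀ Σ))))
       (rD□ (has-⇒ Dr D□ h') {Γ₀ ++ Σ} (exchange (ih ◇≺ d e (swap B C ↭-refl))))
cut-DualM-◇ ih (by-C◇ {h = h'}) h e = ⊥-elim (has-exclusive DualM C◇ h h')
cut-DualM-◇ ih (by-K◇ {h = h'}) h e = ⊥-elim (has-exclusive DualM K◇ h h')
cut-DualM-◇ ih (by-CD {h = h'}) h e = ⊥-elim (has-exclusive DualM CD h h')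

cut-C□ : ∀ {L Γ Σ Σ' B C} {D : L ⊢ Γ ⇒ just (□ B)} → CutBelow (□ B) → RightRule D → Has L C□ →
         L ⊢ B ∷ Σ ⇒ just C → L ⊢ Γ ++ □ₗ Σ ++ Σ' ⇒ just (□ C)
cut-C□ {Σ = Σ} {Σ'} ih (by-C□ {Γ = Γ₀} {Γ₀'} {B₀} {d = d}) h e =
  regroup-cut Γ₀' Σ' Γ₀ Σ [ □ B₀ ] [] ↭-refl ↭-refl (rC□ h {Γ₀ ++ Σ} {Γ₀' ++ Σ'} (ih □≺ d e ↭-refl))
cut-C□ ih (by-M□ {h = h'}) h e = ⊥-elim (has-exclusive C□ M□ h h')
cut-C□ ih (by-N□ {h = h'}) h e = ⊥-elim (has-exclusive C□ N□ h h')
cut-C□ ih (by-K□ {h = h'}) h e = ⊥-elim (has-exclusive C□ K□ h h')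

cut-DualC-□ : ∀ {L Γ Σ Σ' B C Δ} {D : L ⊢ Γ ⇒ just (□ B)} → CutBelow (□ B) → RightRule D → Has L DualC →
              L ⊢ B ∷ C ∷ Σ ⇒ nothing → L ⊢ Γ ++ ◇ C ∷ □ₗ Σ ++ Σ' ⇒ Δ
cut-DualC-□ {Σ = Σ} {Σ'} {C = C} ih (by-C□ {Γ = Γ₀} {Γ₀'} {B₀} {d = d}) h e =
  regroup-cut Γ₀' Σ' Γ₀ Σ [ □ B₀ ] [ ◇ C ] ↭-refl ↭-refl
    (rDualC h {Γ₀ ++ Σ} {Γ₀' ++ Σ'} (perm (prep B₀ (shift C Γ₀ Σ)) (ih □≺ d e ↭-refl)))
cut-DualC-□ ih (by-M□ {h = h'}) h e = ⊥-elim (has-exclusive DualC M□ h h')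
cut-DualC-□ ih (by-N□ {h = h'}) h e = ⊥-elim (has-exclusive DualC N□ h h')
cut-DualC-□ ih (by-K□ {h = h'}) h e = ⊥-elim (has-exclusive DualC K□ h h')

cut-◇ : ∀ {L Γ Σ Σ' B Δ₁ Δ₂} {D : L ⊢ Γ ⇒ just (◇ B)} → CutBelow (◇ B) → RightRule D → ¬ Has L M□ →
        (rule : ∀ {Θ Θ' B'} → L ⊢ B' ∷ Θ ⇒ Δ₁ → L ⊢ Θ' ++ □ₗ Θ ++ [ ◇ B' ] ⇒ Δ₂) →
        (T-rule : Has L T◇ → ∀ {Θ} → L ⊢ Θ ⇒ Δ₁ → L ⊢ Θ ⇒ Δ₂) →
        (CD-rule : Has L CD → ∀ {Θ Θ'} → L ⊢ Θ ⇒ Δ₁ → L ⊢ Θ' ++ □ₗ Θ ⇒ Δ₂) →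
        L ⊢ B ∷ Σ ⇒ Δ₁ → L ⊢ Γ ++ □ₗ Σ ++ Σ' ⇒ Δ₂
cut-◇ {Σ = Σ} {Σ'} ih (by-C◇ {Γ = Γ₀} {Γ₀'} {B₀} {d = d}) ¬M rule T-rule CD-rule e =
  regroup-cut Γ₀' Σ' Γ₀ Σ [ ◇ B₀ ] [] ↭-refl ↭-refl (rule {Γ₀ ++ Σ} {Γ₀' ++ Σ'} (ih ◇≺ d e ↭-refl))
cut-◇ {Σ = Σ} {Σ'} ih (by-K◇ {Γ = Γ₀} {Γ₀'} {B₀} {d = d}) ¬M rule T-rule CD-rule e =
  regroup-cut Γ₀' Σ' Γ₀ Σ [ ◇ B₀ ] [] ↭-refl ↭-refl (rule {Γ₀ ++ Σ} {Γ₀' ++ Σ'} (ih ◇≺ d e ↭-refl))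
cut-◇ {Σ = Σ} {Σ'} ih (by-CD {h = h} {Γ = Γ₀} {Γ₀'} {d = d}) ¬M rule T-rule CD-rule e =
  regroup-cut₀ Γ₀' Σ' Γ₀ Σ ↭-refl ↭-refl (CD-rule h {Γ₀ ++ Σ} {Γ₀' ++ Σ'} (ih ◇≺ d e ↭-refl))
cut-◇ {Σ = Σ} {Σ'} ih (by-T◇ {h = h} {d = d}) ¬M rule T-rule CD-rule e =
  T-rule h (□ₗ-unboxʳ (has-⇒ T◇ T□ h) Σ Σ' (ih ◇≺ d e ↭-refl))
cut-◇ ih (by-M◇ {h = h}) ¬M rule T-rule CD-rule e = ⊥-elim (¬M (has-⇒ M◇ M□ h))
cut-◇ ih (by-P◇ {h = h}) ¬M rule T-rule CD-rule e = ⊥-elim (¬M (has-⇒ P◇ M□ h))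
cut-◇ ih (by-D {h = h}) ¬M rule T-rule CD-rule e = ⊥-elim (¬M (has-⇒ Dr M□ h))

cut-DualC-◇ : ∀ {L Γ Σ Σ' B C Δ} {D : L ⊢ Γ ⇒ just (◇ C)} → CutBelow (◇ C) → RightRule D → Has L DualC →
              L ⊢ B ∷ C ∷ Σ ⇒ nothing → L ⊢ Γ ++ □ B ∷ □ₗ Σ ++ Σ' ⇒ Δ
cut-DualC-◇ {Σ = Σ} {Σ'} {B} {C} ih (by-C◇ {Γ = Γ₀} {Γ₀'} {C₀} {d = d}) h e =
  regroup-cut Γ₀' Σ' Γ₀ Σ [ ◇ C₀ ] [ □ B ] ↭-refl ↭-refl
    (perm (++⁺ˡ (Γ₀' ++ Σ') (++⁺ˡ (□ₗ (Γ₀ ++ Σ)) (swap _ _ ↭-refl))) (rDualC h {Γ₀ ++ Σ} {Γ₀' ++ Σ'}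
      (perm (↭-trans (prep C₀ (shift B Γ₀ Σ)) (swap C₀ B ↭-refl)) (ih ◇≺ d e (swap B C ↭-refl)))))
cut-DualC-◇ {Σ = Σ} {Σ'} {B} {C} ih (by-K◇ {Γ = Γ₀} {Γ₀'} {C₀} {d = d}) h e =
  regroup-cut Γ₀' Σ' Γ₀ Σ [ ◇ C₀ ] [ □ B ] ↭-refl ↭-refl
    (perm (++⁺ˡ (Γ₀' ++ Σ') (++⁺ˡ (□ₗ (Γ₀ ++ Σ)) (swap _ _ ↭-refl))) (rDualC h {Γ₀ ++ Σ} {Γ₀' ++ Σ'}
      (perm (↭-trans (prep C₀ (shift B Γ₀ Σ)) (swap C₀ B ↭-refl)) (ih ◇≺ d e (swap B C ↭-refl)))))
cut-DualC-◇ {Σ = Σ} {Σ'} {B} {C} ih (by-CD {h = h'} {Γ = Γ₀} {Γ₀'} {d = d}) h e =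
  regroup-cut₀ Γ₀' Σ' Γ₀ (B ∷ Σ) ↭-refl ↭-refl
    (rCD□ (has-⇒ CD CD□ h') {Γ₀ ++ B ∷ Σ} {Γ₀' ++ Σ'} (ih ◇≺ d e (swap B C ↭-refl)))
cut-DualC-◇ {Σ = Σ} {Σ'} {B} {C} ih (by-T◇ {h = h'} {d = d}) h e =
  weaken-succ (□ₗ-unboxʳ (has-⇒ T◇ T□ h') (B ∷ Σ) Σ' (ih ◇≺ d e (swap B C ↭-refl)))
cut-DualC-◇ ih (by-M◇ {h = h'}) h e = ⊥-elim (has-exclusive DualC M◇ h h')
cut-DualC-◇ ih (by-P◇ {h = h'}) h e = ⊥-elim (has-exclusive DualC P◇ h h')
cut-DualC-◇ ih (by-D {h = h'}) h e = ⊥-elim (has-exclusive DualC Dr h h')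

-- The cut formula □A lies in the boxed context of a rule with side formulas Ψ and principal
-- formulas R.
cut-in-boxes : ∀ {L Γ Σ Σ' Q A Δ₁ Δ₂} {D : L ⊢ Γ ⇒ just (□ A)} Ψ R → CutBelow (□ A) → RightRule D →
               ¬ Has L M□ → (∀ {Θ Θ'} → L ⊢ Ψ ++ Θ ⇒ Δ₁ → L ⊢ Θ' ++ □ₗ Θ ++ R ⇒ Δ₂) →
               L ⊢ Ψ ++ Σ ⇒ Δ₁ → Σ ↭ A ∷ Q → L ⊢ Γ ++ R ++ □ₗ Q ++ Σ' ⇒ Δ₂
cut-in-boxes {Σ' = Σ'} {Q} {A} Ψ R ih r ¬M rule e t with Γ₀ , Θ , s , d ← box-decomposition r ¬M =
  regroup-cut Γ₀ Σ' Θ Q [] R (↭-trans s (↭-sym (++⁺ˡ Γ₀ (++-identityʳ (□ₗ Θ))))) ↭-refl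
    (rule {Θ ++ Q} {Γ₀ ++ Σ'} (perm (shifts Θ Ψ) (ih □≺ d e (↭-under Ψ [ A ] t))))

cut-modal-rule : ∀ {L Γ Γ' Σ Σ' A X B Δ₁ Δ₂} {D : L ⊢ Γ ⇒ just A} → CutBelow A → RightRule D → ¬ Has L M□ →
                 (rule : ∀ {Θ Θ'} → L ⊢ B ∷ Θ ⇒ Δ₁ → L ⊢ Θ' ++ □ₗ Θ ++ [ X ] ⇒ Δ₂) →
                 (A ≡ X → L ⊢ Γ ++ □ₗ Σ ++ Σ' ⇒ Δ₂) →
                 L ⊢ B ∷ Σ ⇒ Δ₁ → Σ' ++ □ₗ Σ ++ [ X ] ↭ A ∷ Γ' → L ⊢ Γ ++ Γ' ⇒ Δ₂
cut-modal-rule {Γ = Γ} {Σ = Σ} {Σ'} {X = X} {B} ih r ¬M rule principal e q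
  with replace-weakenedʳ Γ Σ' (□ₗ Σ ++ [ X ]) q (λ Θ' → rule {Θ' = Θ'} e)
... | inj₂ d = d
... | inj₁ (ws , p , s) with ∷-□ₗ-↭-∷-inv Σ (↭-trans (++-comm [ X ] (□ₗ Σ)) p)
...   | inj₁ (eq , t) = perm (++⁺ˡ Γ (↭-sym (↭-trans s (++⁺ʳ Σ' (↭-sym t))))) (principal eq)
...   | inj₂ (_ , _ , refl , t , u) =
  perm (++⁺ˡ Γ (↭-sym (↭-trans s (++⁺ʳ Σ' u))))
    (cut-in-boxes [ B ] [ X ] ih r ¬M (λ {Θ} {Θ'} → rule {Θ} {Θ'}) e t)

cut-◇-rule : ∀ {L Γ Γ' Σ Σ' A B Δ₁ Δ₂} {D : L ⊢ Γ ⇒ just A} → CutBelow A → RightRule D → ¬ Has L M□ →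
             (∀ {Θ Θ' B'} → L ⊢ B' ∷ Θ ⇒ Δ₁ → L ⊢ Θ' ++ □ₗ Θ ++ [ ◇ B' ] ⇒ Δ₂) →
             (Has L T◇ → ∀ {Θ} → L ⊢ Θ ⇒ Δ₁ → L ⊢ Θ ⇒ Δ₂) →
             (Has L CD → ∀ {Θ Θ'} → L ⊢ Θ ⇒ Δ₁ → L ⊢ Θ' ++ □ₗ Θ ⇒ Δ₂) →
             L ⊢ B ∷ Σ ⇒ Δ₁ → Σ' ++ □ₗ Σ ++ [ ◇ B ] ↭ A ∷ Γ' → L ⊢ Γ ++ Γ' ⇒ Δ₂
cut-◇-rule {Σ' = Σ'} {B = B} ih r ¬M rule T-rule CD-rule e =
  cut-modal-rule {Σ' = Σ'} {X = ◇ B} ih r ¬M (λ {Θ} {Θ'} → rule {Θ} {Θ'})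
    (λ { refl → cut-◇ ih r ¬M (λ {Θ} {Θ'} → rule {Θ} {Θ'}) T-rule CD-rule e }) e

cut-box-rule : ∀ {L Γ Γ' Σ Σ' A Δ₁ Δ₂} {D : L ⊢ Γ ⇒ just A} → CutBelow A → RightRule D → ¬ Has L M□ →
               (rule : ∀ {Θ Θ'} → L ⊢ Θ ⇒ Δ₁ → L ⊢ Θ' ++ □ₗ Θ ⇒ Δ₂) →
               L ⊢ Σ ⇒ Δ₁ → Σ' ++ □ₗ Σ ↭ A ∷ Γ' → L ⊢ Γ ++ Γ' ⇒ Δ₂
cut-box-rule {Γ = Γ} {Σ = Σ} {Σ'} ih r ¬M rule e q
  with replace-weakenedʳ Γ Σ' (□ₗ Σ) q (λ Θ' → rule {Θ' = Θ'} e)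
... | inj₂ d = d
... | inj₁ (ws , p , s) with _ , _ , refl , t , refl ← map-↭-∷-inv □ Σ p =
  perm (++⁺ˡ Γ (↭-sym s)) (cut-in-boxes [] [] ih r ¬M (λ {Θ} {Θ'} d → append-[] Θ' (□ₗ Θ) (rule d)) e t)

cut-DualC-rule : ∀ {L Γ Γ' Σ Σ' A B C Δ} {D : L ⊢ Γ ⇒ just A} → CutBelow A → RightRule D → Has L DualC →
                 L ⊢ B ∷ C ∷ Σ ⇒ nothing → Σ' ++ □ₗ Σ ++ □ B ∷ ◇ C ∷ [] ↭ A ∷ Γ' → L ⊢ Γ ++ Γ' ⇒ Δ
cut-DualC-rule {Γ = Γ} {Σ = Σ} {Σ'} {B = B} {C} ih r h e q
  with replace-weakenedʳ Γ Σ' (□ₗ Σ ++ □ B ∷ ◇ C ∷ []) q (λ Θ' → rDualC h {Σ} {Θ'} e)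
... | inj₂ d = d
... | inj₁ (ws , p , s)
  with ∷-↭-∷-inv (↭-trans (swap _ _ ↭-refl) (↭-trans (++-comm (□ B ∷ ◇ C ∷ []) (□ₗ Σ)) p))
...   | inj₁ (refl , t) = perm (++⁺ˡ Γ (↭-sym (↭-trans s (++⁺ʳ Σ' (↭-sym t))))) (cut-DualC-◇ ih r h e)
...   | inj₂ (zs , t , u) with ∷-□ₗ-↭-∷-inv Σ t
...     | inj₁ (refl , v) =
  perm (++⁺ˡ Γ (↭-sym (↭-trans s (++⁺ʳ Σ' (↭-trans u (prep _ (↭-sym v))))))) (cut-DualC-□ ih r h e)
...     | inj₂ (_ , _ , refl , v , w) =
  perm (++⁺ˡ Γ (↭-sym (↭-trans s (++⁺ʳ Σ' (↭-trans u (↭-trans (prep _ w) (swap _ _ ↭-refl)))))))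
       (cut-in-boxes (B ∷ C ∷ []) (□ B ∷ ◇ C ∷ []) ih r (has-exclusive DualC M□ h)
           (λ {Θ} {Θ'} → rDualC h {Θ} {Θ'}) e v)

cut-right : ∀ {L Γ Π Γ' A Δ} {D : L ⊢ Γ ⇒ just A} → CutBelow A → RightRule D →
            L ⊢ Π ⇒ Δ → Π ↭ A ∷ Γ' → L ⊢ Γ ++ Γ' ⇒ Δ
cut-right ih r (perm p e) q = cut-right ih r e (↭-trans p q)
cut-right {Γ = Γ} ih r init q with ∷-↭-∷-inv q
... | inj₁ (refl , _) with by-init ← r = init
... | inj₂ (_ , _ , p) = restore₁ Γ p init
cut-right {Γ = Γ} ih r L⊥ q with ∷-↭-∷-inv q
... | inj₁ (refl , _) with () ← r
... | inj₂ (_ , _ , p) = restore₁ Γ p L⊥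
cut-right {Γ = Γ} ih r (L⊃ e₁ e₂) q with ∷-↭-∷-inv q
... | inj₁ (refl , p) = cut-⊃ ih r (cut-right ih r e₁ (prep _ p)) (perm (prep _ p) e₂)
... | inj₂ (_ , p₁ , p₂) = restore₁ Γ p₂
  (L⊃ (unshift₁ Γ (cut-right ih r e₁ (↭-under [ _ ] [ _ ] p₁)))
      (unshift₁ Γ (cut-right ih r e₂ (↭-under [ _ ] [ _ ] p₁))))
cut-right {Γ = Γ} ih r (R⊃ e) q = R⊃ (unshift₁ Γ (cut-right ih r e (↭-under [ _ ] [ _ ] q)))
cut-right ih r (R∧ e₁ e₂) q = R∧ (cut-right ih r e₁ q) (cut-right ih r e₂ q)
cut-right {Γ = Γ} ih r (L∧ e) q with ∷-↭-∷-inv q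
... | inj₁ (refl , p) = cut-∧ ih r (perm (prep _ (prep _ p)) e)
... | inj₂ (_ , p₁ , p₂) = restore₁ Γ p₂ (L∧ (unshift₂ Γ (cut-right ih r e (↭-under (_ ∷ _ ∷ []) [ _ ] p₁))))
cut-right ih r (R∨₁ e) q = R∨₁ (cut-right ih r e q)
cut-right ih r (R∨₂ e) q = R∨₂ (cut-right ih r e q)
cut-right {Γ = Γ} ih r (L∨ e₁ e₂) q with ∷-↭-∷-inv q
... | inj₁ (refl , p) = cut-∨ ih r (perm (prep _ p) e₁) (perm (prep _ p) e₂)
... | inj₂ (_ , p₁ , p₂) = restore₁ Γ p₂
  (L∨ (unshift₁ Γ (cut-right ih r e₁ (↭-under [ _ ] [ _ ] p₁)))
      (unshift₁ Γ (cut-right ih r e₂ (↭-under [ _ ] [ _ ] p₁))))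
cut-right {Γ = Γ} ih r (rM□ h e) q with ∷-↭-∷-inv q
... | inj₁ (refl , p) = perm (++⁺ˡ Γ p) (cut-M□ ih r h e)
... | inj₂ (_ , _ , p) = restore₁ Γ p (rM□ h e)
cut-right {Γ = Γ} ih r (rM◇ h e) q with ∷-↭-∷-inv q
... | inj₁ (refl , p) = perm (++⁺ˡ Γ p) (cut-M◇ ih r h e)
... | inj₂ (_ , _ , p) = restore₁ Γ p (rM◇ h e)
cut-right {Γ = Γ} ih r (rDualM h e) q with ∷-↭-∷-inv q
... | inj₁ (refl , p) = perm (++⁺ˡ Γ p) (cut-DualM-□ ih r h e)
... | inj₂ (_ , p₁ , p₂) with ∷-↭-∷-inv p₁
...   | inj₁ (refl , p₃) = perm (++⁺ˡ Γ (↭-sym (↭-trans p₂ (prep _ (↭-sym p₃))))) (cut-DualM-◇ ih r h e)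
...   | inj₂ (_ , _ , p₃) = restore₂ Γ (↭-trans p₂ (prep _ p₃)) (rDualM h e)
cut-right ih r (rN□ h e) q = rN□ h e
cut-right {Γ = Γ} ih r (rN◇ h e) q with ∷-↭-∷-inv q
... | inj₁ (refl , p) = perm (++⁺ˡ Γ p) (cut-N◇ ih r h e)
... | inj₂ (_ , _ , p) = restore₁ Γ p (rN◇ h e)
cut-right ih r (rC□ h {Γ' = Σ'} {B} e) q =
  cut-modal-rule {Σ' = Σ'} {X = □ B} ih r (has-exclusive C□ M□ h) (λ {Θ} {Θ'} → rC□ h {Θ} {Θ'})
    (λ { refl → cut-C□ ih r h e }) e q
cut-right ih r (rC◇ h {Γ' = Σ'} e) q =
  cut-◇-rule {Σ' = Σ'} ih r (has-exclusive C◇ M□ h) (λ {Θ} {Θ'} → rC◇ h {Θ} {Θ'})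
    (λ h′ → rT◇ h′) (λ h′ {Θ} {Θ'} → rCD h′ {Θ} {Θ'}) e q
cut-right ih r (rDualC h {Γ' = Σ'} e) q = cut-DualC-rule {Σ' = Σ'} ih r h e q
cut-right ih r (rK□ h {Γ' = Σ'} e) q =
  cut-box-rule {Σ' = Σ'} ih r (has-exclusive K□ M□ h) (λ {Θ} {Θ'} → rK□ h {Θ} {Θ'}) e q
cut-right ih r (rK◇ h {Γ' = Σ'} e) q =
  cut-◇-rule {Σ' = Σ'} ih r (has-exclusive K◇ M□ h) (λ {Θ} {Θ'} → rK◇ h {Θ} {Θ'})
    (λ h′ → rT◇ h′) (λ h′ {Θ} {Θ'} → rCD h′ {Θ} {Θ'}) e q
cut-right ih r (rDualK h {Γ' = Σ'} e) q =
  cut-◇-rule {Σ' = Σ'} ih r (has-exclusive DualK M□ h) (λ {Θ} {Θ'} → rDualK h {Θ} {Θ'})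
    (λ _ → weaken-succ) (λ h′ {Θ} {Θ'} → rCD□ (has-⇒ CD CD□ h′) {Θ} {Θ'}) e q
cut-right {Γ = Γ} ih r (rT□ h e) q with ∷-↭-∷-inv q
... | inj₁ (refl , p) = cut-T□ ih r h (cut-right ih r e (prep _ (prep _ p)))
... | inj₂ (_ , p₁ , p₂) =
  restore₁ Γ p₂ (rT□ h (unshift₂ Γ (cut-right ih r e (↭-under (_ ∷ _ ∷ []) [ _ ] p₁))))
cut-right ih r (rT◇ h e) q = rT◇ h (cut-right ih r e q)
cut-right {Γ = Γ} ih r (rP□ h e) q with ∷-↭-∷-inv q
... | inj₁ (refl , p) = perm (++⁺ˡ Γ p) (cut-P□ ih r h e)
... | inj₂ (_ , _ , p) = restore₁ Γ p (rP□ h e)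
cut-right ih r (rP◇ h e) q = rP◇ h e
cut-right {Γ = Γ} ih r (rD h e) q with ∷-↭-∷-inv q
... | inj₁ (refl , p) = perm (++⁺ˡ Γ p) (cut-D ih r h e)
... | inj₂ (_ , _ , p) = restore₁ Γ p (rD h e)
cut-right {Γ = Γ} ih r (rD□ h e) q with ∷-↭-∷-inv q
... | inj₁ (refl , p) = perm (++⁺ˡ Γ p) (cut-D□ ih r h e)
... | inj₂ (_ , p₁ , p₂) with ∷-↭-∷-inv p₁
...   | inj₁ (refl , p₃) = perm (++⁺ˡ Γ (↭-sym (↭-trans p₂ (prep _ (↭-sym p₃))))) (cut-D□ ih r h (exchange e))
...   | inj₂ (_ , _ , p₃) = restore₂ Γ (↭-trans p₂ (prep _ p₃)) (rD□ h e)
cut-right ih r (rCD h {Γ' = Σ'} e) q =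
  cut-box-rule {Σ' = Σ'} ih r (has-exclusive CD M□ h) (λ {Θ} {Θ'} → rCD h {Θ} {Θ'}) e q
cut-right ih r (rCD□ h {Γ' = Σ'} e) q =
  cut-box-rule {Σ' = Σ'} ih r (has-exclusive CD□ M□ h) (λ {Θ} {Θ'} → rCD□ h {Θ} {Θ'}) e q

weakened-instance : ∀ {L P Δ} Γ₁ Γ' → (∀ Θ → L ⊢ Θ ++ P ⇒ Δ) → L ⊢ (Γ₁ ++ P) ++ Γ' ⇒ Δ
weakened-instance {P = P} Γ₁ Γ' rule = perm (regroup Γ₁ Γ' P) (rule (Γ₁ ++ Γ'))
  where
  regroup : (a g m : Ctx) → (a ++ g) ++ m ↭ (a ++ m) ++ g
  regroup = solve 3 (λ a g m → (a ⊕ g) ⊕ m ⊜ (a ⊕ m) ⊕ g) ↭-refl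

cut-left : ∀ {A} → CutBelow A → Cut A
cut-left ih {Γ' = Γ'} (perm p d) e q = perm (++⁺ʳ Γ' p) (cut-left ih d e q)
cut-left ih D@init e q = cut-right {D = D} ih by-init e q
cut-left ih L⊥ e q = L⊥
cut-left ih {Γ' = Γ'} (L⊃ d₁ d₂) e q = L⊃ (weakenʳ Γ' d₁) (cut-left ih d₂ e q)
cut-left ih D@(R⊃ d) e q = cut-right {D = D} ih by-R⊃ e q
cut-left ih D@(R∧ d₁ d₂) e q = cut-right {D = D} ih by-R∧ e q
cut-left ih (L∧ d) e q = L∧ (cut-left ih d e q)
cut-left ih D@(R∨₁ d) e q = cut-right {D = D} ih by-R∨₁ e q
cut-left ih D@(R∨₂ d) e q = cut-right {D = D} ih by-R∨₂ e q
cut-left ih (L∨ d₁ d₂) e q = L∨ (cut-left ih d₁ e q) (cut-left ih d₂ e q)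
cut-left ih D@(rM□ h d) e q = cut-right {D = D} ih by-M□ e q
cut-left ih D@(rM◇ h d) e q = cut-right {D = D} ih by-M◇ e q
cut-left ih (rDualM h d) e q = rDualM h d
cut-left ih D@(rN□ h d) e q = cut-right {D = D} ih by-N□ e q
cut-left ih (rN◇ h d) e q = rN◇ h d
cut-left ih D@(rC□ h d) e q = cut-right {D = D} ih by-C□ e q
cut-left ih D@(rC◇ h d) e q = cut-right {D = D} ih by-C◇ e q
cut-left ih {Γ' = Γ'} (rDualC h {Γ₀} {Γ₁} d) e q = weakened-instance Γ₁ Γ' (λ Θ → rDualC h {Γ₀} {Θ} d)
cut-left ih D@(rK□ h d) e q = cut-right {D = D} ih by-K□ e q
cut-left ih D@(rK◇ h d) e q = cut-right {D = D} ih by-K◇ e q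
cut-left ih {Γ' = Γ'} (rDualK h {Γ₀} {Γ₁} d) e q = weakened-instance Γ₁ Γ' (λ Θ → rDualK h {Γ₀} {Θ} d)
cut-left ih (rT□ h d) e q = rT□ h (cut-left ih d e q)
cut-left ih D@(rT◇ h d) e q = cut-right {D = D} ih by-T◇ e q
cut-left ih (rP□ h d) e q = rP□ h d
cut-left ih D@(rP◇ h d) e q = cut-right {D = D} ih by-P◇ e q
cut-left ih D@(rD h d) e q = cut-right {D = D} ih by-D e q
cut-left ih (rD□ h d) e q = rD□ h d
cut-left ih D@(rCD h d) e q = cut-right {D = D} ih by-CD e q
cut-left ih {Γ' = Γ'} (rCD□ h {Γ₀} {Γ₁} d) e q = weakened-instance Γ₁ Γ' (λ Θ → rCD□ h {Γ₀} {Θ} d)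

cut-admissible : ∀ A → Cut A
cut-admissible = All.wfRec ≺-wellFounded _ Cut (λ _ → cut-left)

theorem3p2 : (L : Calc) → ∀ {Γ Γ' A Δ} →
    L ⊢ Γ ⇒ just A → L ⊢ A ∷ Γ' ⇒ Δ → L ⊢ Γ ++ Γ' ⇒ Δ
theorem3p2 L {A = A} D E = cut-admissible A D E ↭-refl
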